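{- For $1\le k\le n\le 5k$ the following congruences hold modulo $5$: if $n-k$ is even, $r(n,k)\equiv \frac{(2n)!}{\left(\frac{5k-n}{2}\right)!\left(\frac{n-k}{2}\right)!\,5^{\frac{n-k}{2}}}$; if $n-k$ is odd, $r(n,k)\equiv \frac{2\,(2n)!}{\left(\frac{5k-n-1}{2}\right)!\left(\frac{n-k-1}{2}\right)!\,5^{\frac{n-k-1}{2}}}$ (the right-hand sides being integers). If $1\le k$ and $n>5k$, then $r(n,k)\equiv 0 \pmod 5$.
   Context: Define the integer sequence $u$ by $u(0)=1$ and, for $n\ge 1$, $u(n)=\Big(\prod_{j=1}^{n}(4j-1)\Big)^2-\sum_{m=0}^{n-1}\binom{2n+1}{2m+1}\Big(\prod_{j=1}^{n-m}(4j-3)\Big)^2u(m)$. For $1\le k\le n$ define $s(n,k)=\frac{(2n)!}{(2k)!}[z^{2n}]\Big(\sum_{j=0}^\infty \frac{u(j)}{(2j+1)!}z^{2j+1}\Big)^{2k}$ (coefficient of $z^{2n}$) and $r(n,k)=2^{n-k}s(n,k)$; these are integers. -}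

module Defs where

open import Data.Nat as ℕ using (ℕ; zero; suc; _∸_; _!; _%_; NonZero)
open import Data.Nat.Properties using (_!≢0; m*n≢0; m^n≢0)
open import Data.Nat.Combinatorics using (_C_)
open import Data.Integer as ℤ using (ℤ; +_)
open import Data.Rational as ℚ using (ℚ; _/_)
open import Data.Fin using (Fin; toℕ; fromℕ)
open import Data.Vec using (Vec; []; _∷ʳ_; lookup)
open import Data.Product using (∃-syntax)
open import Relation.Binary.PropositionalEquality using (_≡_)
open import Relation.Nullary using (yes; no)

prodFrom1 : ℕ → (ℕ → ℕ) → ℕ
prodFrom1 zero    f = 1
prodFrom1 (suc n) f = prodFrom1 n f ℕ.* f (suc n)

P Q : ℕ → ℕ
P n = prodFrom1 n (λ j → 4 ℕ.* j ∸ 1)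
Q n = prodFrom1 n (λ j → 4 ℕ.* j ∸ 3)

sumFin : (n : ℕ) → (Fin n → ℤ) → ℤ
sumFin zero    f = + 0
sumFin (suc n) f = f Fin.zero ℤ.+ sumFin n (λ i → f (Fin.suc i))

uStep : (n : ℕ) → (Fin n → ℤ) → ℤ
uStep zero    prev = + 1
uStep (suc n) prev =
  + (P (suc n) ℕ.^ 2) ℤ.-
  sumFin (suc n) (λ m →
    + ((2 ℕ.* suc n ℕ.+ 1) C (2 ℕ.* toℕ m ℕ.+ 1) ℕ.* (Q (suc n ∸ toℕ m) ℕ.^ 2)) ℤ.* prev m)

uVec : (n : ℕ) → Vec ℤ n
uVec zero    = []
uVec (suc n) = uVec n ∷ʳ uStep n (lookup (uVec n))

u : ℕ → ℤ
u n = lookup (uVec (suc n)) (fromℕ n)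

Series : Set
Series = ℕ → ℚ

sumUpTo : ℕ → (ℕ → ℚ) → ℚ
sumUpTo zero    f = f 0
sumUpTo (suc N) f = sumUpTo N f ℚ.+ f (suc N)

_⊛_ : Series → Series → Series
(f ⊛ g) N = sumUpTo N (λ i → f i ℚ.* g (N ∸ i))

one : Series
one zero    = ℚ.1ℚ
one (suc _) = ℚ.0ℚ

_^ₛ_ : Series → ℕ → Series
F ^ₛ zero  = one
F ^ₛ suc m = (F ^ₛ m) ⊛ F

F : Series
F N with N % 2 ℕ.≟ 1
... | yes _ = _/_ (u (N ℕ./ 2)) (N !) {{N !≢0}}
... | no  _ = ℚ.0ℚ

s : ℕ → ℕ → ℚ
s n k = (_/_ (+ ((2 ℕ.* n) !)) ((2 ℕ.* k) !) {{(2 ℕ.* k) !≢0}}) ℚ.* ((F ^ₛ (2 ℕ.* k)) (2 ℕ.* n))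

r : ℕ → ℕ → ℚ
r n k = ((+ (2 ℕ.^ (n ∸ k))) / 1) ℚ.* s n k

fracFact : ℕ → ℕ → ℕ → ℕ → ℕ → ℚ
fracFact m a b c d =
  _/_ (+ (m ℕ.* a !)) (b ! ℕ.* c ! ℕ.* 5 ℕ.^ d)
      {{m*n≢0 _ _ {{m*n≢0 _ _ {{b !≢0}} {{c !≢0}}}} {{m^n≢0 5 d}}}}

IsInt : ℚ → Set
IsInt x = ∃[ z ] x ≡ z / 1

_≡₅_ : ℚ → ℚ → Set
x ≡₅ y = ∃[ m ] x ℚ.- y ≡ (+ 5 ℤ.* m) / 1

{-# OPTIONS --safe #-}
module Submission where

-- Write F = Σ fₙ zⁿ/n!. Then s(n,k) is the coefficient of z²ⁿ/(2n)! in the divided power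
-- F^[2k] = F²ᵏ/(2k)!, an integer polynomial in the fₙ. As u(j) ≡ 0 (mod 5) for j ≥ 3, F is
-- congruent to G = z + z⁵/5! + z³/3! coefficientwise, and divided powers respect such
-- congruences. By the binomial theorem for divided powers, with A = z + z⁵/5!,
-- G^[m] ≡ A^[m] + (z³/3!)·A^[m−1], since (z³/3!)^[j] = ((3j)!/(j!6ʲ))·z³ʲ/(3j)! and 5 divides
-- (3j)!/(j!6ʲ) for j ≥ 2; likewise A^[m] = Σₗ ((5l)!/(l!120ˡ))·z^(m−l)/(m−l)!·z⁵ˡ/(5l)!.
-- At z²ⁿ at most one term survives, and which one depends on the parity of n − k. Finally
-- 2^(n−k) = 4ᵇ and (5b)!/(b!120ᵇ) = (5b)!/(b!5ᵇ4ᵇ6ᵇ) with 6ᵇ ≡ 1 give the stated quotients.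

open import Data.Nat as ℕ using (ℕ; zero; suc; _∸_; _≤_; _<_; z≤n; s≤s; _!)
import Data.Nat.Properties as ℕP
open import Data.Nat.Combinatorics using (_C_; k>n⇒nCk≡0; nCk+nC[k+1]≡[n+1]C[k+1])
open import Data.Integer as ℤ using (ℤ; +_)
import Data.Integer.Properties as ℤP
open import Data.Integer.Tactic.RingSolver using (solve-∀)
open import Data.Empty using (⊥-elim)
open import Function using (_∘_)
open import Relation.Nullary using (yes; no)
open import Relation.Binary.PropositionalEquality
open import Defs using (u; uVec; sumFin; P; Q)

module ExponentialSeries where

  open import Data.Integer using (_+_; _*_)
  import Algebra.Properties.CommutativeSemigroup ℤP.+-commutativeSemigroup as +-CS
  import Algebra.Properties.CommutativeSemigroup ℤP.*-commutativeSemigroup as *-CS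

  -- x stands for the series Σ xₙ zⁿ/n!: shift is its derivative, and _⋆_ is the
  -- product, defined through the Leibniz rule.
  Seq : Set
  Seq = ℕ → ℤ

  shift : Seq → Seq
  shift x n = x (suc n)

  infixl 6 _⊕_
  infixl 7 _⋆_
  infixr 8 _·_

  _⊕_ : Seq → Seq → Seq
  (x ⊕ y) n = x n + y n

  _·_ : ℤ → Seq → Seq
  (c · x) n = c * x n

  𝟘 : Seq
  𝟘 _ = + 0

  _⋆_ : Seq → Seq → Seq
  (x ⋆ y) zero    = x 0 * y 0
  (x ⋆ y) (suc n) = (shift x ⋆ y) n + (x ⋆ shift y) n

  ⋆-cong : ∀ {x x′ y y′} → x ≗ x′ → y ≗ y′ → x ⋆ y ≗ x′ ⋆ y′
  ⋆-cong x≗x′ y≗y′ zero    = cong₂ _*_ (x≗x′ 0) (y≗y′ 0)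
  ⋆-cong x≗x′ y≗y′ (suc n) =
    cong₂ _+_ (⋆-cong (x≗x′ ∘ suc) y≗y′ n) (⋆-cong x≗x′ (y≗y′ ∘ suc) n)

  ⋆-comm : ∀ x y → x ⋆ y ≗ y ⋆ x
  ⋆-comm x y zero    = ℤP.*-comm (x 0) (y 0)
  ⋆-comm x y (suc n) = trans (cong₂ _+_ (⋆-comm (shift x) y n) (⋆-comm x (shift y) n))
                             (ℤP.+-comm ((y ⋆ shift x) n) ((shift y ⋆ x) n))

  ⋆-distribʳ-⊕ : ∀ x y z → (x ⊕ y) ⋆ z ≗ x ⋆ z ⊕ y ⋆ z
  ⋆-distribʳ-⊕ x y z zero    = ℤP.*-distribʳ-+ (z 0) (x 0) (y 0)
  ⋆-distribʳ-⊕ x y z (suc n) =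
    trans (cong₂ _+_ (⋆-distribʳ-⊕ (shift x) (shift y) z n) (⋆-distribʳ-⊕ x y (shift z) n))
          (+-CS.interchange ((shift x ⋆ z) n) ((shift y ⋆ z) n) ((x ⋆ shift z) n) ((y ⋆ shift z) n))

  ⋆-distribˡ-⊕ : ∀ x y z → x ⋆ (y ⊕ z) ≗ x ⋆ y ⊕ x ⋆ z
  ⋆-distribˡ-⊕ x y z zero    = ℤP.*-distribˡ-+ (x 0) (y 0) (z 0)
  ⋆-distribˡ-⊕ x y z (suc n) =
    trans (cong₂ _+_ (⋆-distribˡ-⊕ (shift x) y z n) (⋆-distribˡ-⊕ x (shift y) (shift z) n))
          (+-CS.interchange ((shift x ⋆ y) n) ((shift x ⋆ z) n) ((x ⋆ shift y) n) ((x ⋆ shift z) n))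

  ⋆-scaleˡ : ∀ c x y → c · x ⋆ y ≗ c · (x ⋆ y)
  ⋆-scaleˡ c x y zero    = ℤP.*-assoc c (x 0) (y 0)
  ⋆-scaleˡ c x y (suc n) =
    trans (cong₂ _+_ (⋆-scaleˡ c (shift x) y n) (⋆-scaleˡ c x (shift y) n)) (sym (ℤP.*-distribˡ-+ c _ _))

  ⋆-scaleʳ : ∀ c x y → x ⋆ c · y ≗ c · (x ⋆ y)
  ⋆-scaleʳ c x y zero    = *-CS.x∙yz≈y∙xz (x 0) c (y 0)
  ⋆-scaleʳ c x y (suc n) =
    trans (cong₂ _+_ (⋆-scaleʳ c (shift x) y n) (⋆-scaleʳ c x (shift y) n)) (sym (ℤP.*-distribˡ-+ c _ _))

  ⋆-zeroˡ : ∀ y → 𝟘 ⋆ y ≗ 𝟘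
  ⋆-zeroˡ y zero    = refl
  ⋆-zeroˡ y (suc n) = cong₂ _+_ (⋆-zeroˡ y n) (⋆-zeroˡ (shift y) n)

  ⋆-zeroʳ : ∀ x → x ⋆ 𝟘 ≗ 𝟘
  ⋆-zeroʳ x n = trans (⋆-comm x 𝟘 n) (⋆-zeroˡ x n)

  ⋆-assoc : ∀ x y z → (x ⋆ y) ⋆ z ≗ x ⋆ (y ⋆ z)
  ⋆-assoc x y z zero    = ℤP.*-assoc (x 0) (y 0) (z 0)
  ⋆-assoc x y z (suc n) = begin
      ((shift x ⋆ y ⊕ x ⋆ shift y) ⋆ z) n + ((x ⋆ y) ⋆ shift z) n
    ≡⟨ cong (_+ ((x ⋆ y) ⋆ shift z) n) (⋆-distribʳ-⊕ (shift x ⋆ y) (x ⋆ shift y) z n) ⟩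
      (((shift x ⋆ y) ⋆ z) n + ((x ⋆ shift y) ⋆ z) n) + ((x ⋆ y) ⋆ shift z) n
    ≡⟨ cong₂ _+_ (cong₂ _+_ (⋆-assoc (shift x) y z n) (⋆-assoc x (shift y) z n)) (⋆-assoc x y (shift z) n) ⟩
      ((shift x ⋆ (y ⋆ z)) n + (x ⋆ (shift y ⋆ z)) n) + (x ⋆ (y ⋆ shift z)) n
    ≡⟨ ℤP.+-assoc ((shift x ⋆ (y ⋆ z)) n) ((x ⋆ (shift y ⋆ z)) n) ((x ⋆ (y ⋆ shift z)) n) ⟩
      (shift x ⋆ (y ⋆ z)) n + ((x ⋆ (shift y ⋆ z)) n + (x ⋆ (y ⋆ shift z)) n)
    ≡⟨ cong (λ t → (shift x ⋆ (y ⋆ z)) n + t) (sym (⋆-distribˡ-⊕ x (shift y ⋆ z) (y ⋆ shift z) n)) ⟩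
      (shift x ⋆ (y ⋆ z)) n + (x ⋆ shift (y ⋆ z)) n
    ∎
    where open ≡-Reasoning

  δ : ℕ → Seq
  δ zero    zero    = + 1
  δ zero    (suc n) = + 0
  δ (suc j) zero    = + 0
  δ (suc j) (suc n) = δ j n

  δ-diag : ∀ j → δ j j ≡ + 1
  δ-diag zero    = refl
  δ-diag (suc j) = δ-diag j

  δ-off : ∀ j n → j ≢ n → δ j n ≡ + 0
  δ-off zero    zero    j≢n = ⊥-elim (j≢n refl)
  δ-off zero    (suc n) j≢n = refl
  δ-off (suc j) zero    j≢n = refl
  δ-off (suc j) (suc n) j≢n = δ-off j n (j≢n ∘ cong suc)

  ⋆-identityʳ : ∀ x → x ⋆ δ 0 ≗ x
  ⋆-identityʳ x zero    = ℤP.*-identityʳ (x 0)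
  ⋆-identityʳ x (suc n) = trans (cong₂ _+_ (⋆-identityʳ (shift x) n) (⋆-zeroʳ x n)) (ℤP.+-identityʳ _)

  private
    nC[1+j]-shift-index : ∀ n j (y : Seq) → + (n C suc j) * y (suc (n ∸ suc j)) ≡ + (n C suc j) * y (n ∸ j)
    nC[1+j]-shift-index n j y with j ℕP.<? n
    ... | yes j<n = cong (λ i → + (n C suc j) * y i) (sym (ℕP.+-∸-assoc 1 j<n))
    ... | no  j≮n rewrite k>n⇒nCk≡0 (s≤s (ℕP.≮⇒≥ j≮n)) =
      trans (ℤP.*-zeroˡ (y (suc (n ∸ suc j)))) (sym (ℤP.*-zeroˡ (y (n ∸ j))))

  δ-⋆ : ∀ j y n → (δ j ⋆ y) n ≡ + (n C j) * y (n ∸ j)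
  δ-⋆ zero    y zero    = refl
  δ-⋆ (suc j) y zero    = refl
  δ-⋆ zero    y (suc n) = trans (cong₂ _+_ (⋆-zeroˡ y n) (δ-⋆ 0 (shift y) n)) (ℤP.+-identityˡ _)
  δ-⋆ (suc j) y (suc n) = begin
      (δ j ⋆ y) n + (δ (suc j) ⋆ shift y) n
    ≡⟨ cong₂ _+_ (δ-⋆ j y n) (trans (δ-⋆ (suc j) (shift y) n) (nC[1+j]-shift-index n j y)) ⟩
      + (n C j) * y (n ∸ j) + + (n C suc j) * y (n ∸ j)
    ≡⟨ sym (ℤP.*-distribʳ-+ (y (n ∸ j)) (+ (n C j)) (+ (n C suc j))) ⟩
      (+ (n C j) + + (n C suc j)) * y (n ∸ j)
    ≡⟨ cong (λ c → + c * y (n ∸ j)) (nCk+nC[k+1]≡[n+1]C[k+1] n j) ⟩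
      + (suc n C suc j) * y (n ∸ j)
    ∎
    where open ≡-Reasoning

  ∑≤ : ℕ → (ℕ → ℤ) → ℤ
  ∑≤ zero    h = h 0
  ∑≤ (suc m) h = ∑≤ m h + h (suc m)

  syntax ∑≤ m (λ j → h) = ∑[ j ≤ m ] h

  ∑-cong : ∀ m {h h′ : ℕ → ℤ} → (∀ j → j ≤ m → h j ≡ h′ j) → ∑≤ m h ≡ ∑≤ m h′
  ∑-cong zero    h≡h′ = h≡h′ 0 z≤n
  ∑-cong (suc m) h≡h′ =
    cong₂ _+_ (∑-cong m (λ j j≤m → h≡h′ j (ℕP.m≤n⇒m≤1+n j≤m))) (h≡h′ (suc m) ℕP.≤-refl)

  ∑-distrib-+ : ∀ m (h h′ : ℕ → ℤ) → ∑[ j ≤ m ] (h j + h′ j) ≡ ∑≤ m h + ∑≤ m h′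
  ∑-distrib-+ zero    h h′ = refl
  ∑-distrib-+ (suc m) h h′ =
    trans (cong (_+ (h (suc m) + h′ (suc m))) (∑-distrib-+ m h h′)) (+-CS.interchange (∑≤ m h) (∑≤ m h′) _ _)

  ∑-head : ∀ m (h : ℕ → ℤ) → ∑≤ (suc m) h ≡ h 0 + ∑≤ m (h ∘ suc)
  ∑-head zero    h = refl
  ∑-head (suc m) h = trans (cong (_+ h (suc (suc m))) (∑-head m h)) (ℤP.+-assoc (h 0) _ _)

  ∑-zero : ∀ m {h : ℕ → ℤ} → (∀ j → j ≤ m → h j ≡ + 0) → ∑≤ m h ≡ + 0
  ∑-zero zero    h≡0 = h≡0 0 z≤n
  ∑-zero (suc m) h≡0 =
    cong₂ _+_ (∑-zero m (λ j j≤m → h≡0 j (ℕP.m≤n⇒m≤1+n j≤m))) (h≡0 (suc m) ℕP.≤-refl)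

  ∑-single : ∀ m {h : ℕ → ℤ} l → l ≤ m → (∀ j → j ≤ m → j ≢ l → h j ≡ + 0) → ∑≤ m h ≡ h l
  ∑-single zero    zero    z≤n _   = refl
  ∑-single (suc m) {h} l l≤1+m h≡0 with l ℕ.≟ suc m
  ... | yes refl = trans (cong (_+ h (suc m)) (∑-zero m λ j j≤m → h≡0 j (ℕP.m≤n⇒m≤1+n j≤m) (ℕP.<⇒≢ (s≤s j≤m))))
                         (ℤP.+-identityˡ _)
  ... | no  l≢1+m =
    trans (cong₂ _+_ (∑-single m l (ℕP.≤-pred (ℕP.≤∧≢⇒< l≤1+m l≢1+m))
                                   (λ j j≤m → h≡0 j (ℕP.m≤n⇒m≤1+n j≤m)))
                     (h≡0 (suc m) ℕP.≤-refl (l≢1+m ∘ sym)))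
          (ℤP.+-identityʳ _)

  ⋆-∑ : ∀ x m (y : ℕ → Seq) → x ⋆ (λ n → ∑[ j ≤ m ] y j n) ≗ λ n → ∑[ j ≤ m ] (x ⋆ y j) n
  ⋆-∑ x zero    y n = refl
  ⋆-∑ x (suc m) y n =
    trans (⋆-distribˡ-⊕ x (λ t → ∑[ j ≤ m ] y j t) (y (suc m)) n) (cong (_+ (x ⋆ y (suc m)) n) (⋆-∑ x m y n))

  binomialSum : Seq → Seq → Seq
  binomialSum x y n = ∑[ i ≤ n ] (+ (n C i) * x i * y (n ∸ i))

  private
    zeroˡ² : ∀ a b → + 0 * a * b ≡ + 0
    zeroˡ² a b = trans (cong (_* b) (ℤP.*-zeroˡ a)) (ℤP.*-zeroˡ b)

    binomialSum-shiftʳ : ∀ x y n →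
      binomialSum x (shift y) n ≡ x 0 * y (suc n) + ∑[ i ≤ n ] (+ (n C suc i) * x (suc i) * y (n ∸ i))
    binomialSum-shiftʳ x y zero    = begin
        + 1 * x 0 * y 1                  ≡⟨ cong (_* y 1) (ℤP.*-identityˡ (x 0)) ⟩
        x 0 * y 1                        ≡⟨ ℤP.+-identityʳ _ ⟨
        x 0 * y 1 + + 0                  ≡⟨ cong (λ t → x 0 * y 1 + t) (zeroˡ² (x 1) (y 0)) ⟨
        x 0 * y 1 + + 0 * x 1 * y 0      ∎
      where open ≡-Reasoning
    binomialSum-shiftʳ x y (suc n) = begin
        ∑[ i ≤ suc n ] (+ (suc n C i) * x i * y (suc (suc n ∸ i)))
      ≡⟨ ∑-head n _ ⟩
        + 1 * x 0 * y (suc (suc n)) + ∑[ i ≤ n ] (+ (suc n C suc i) * x (suc i) * y (suc (n ∸ i)))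
      ≡⟨ cong₂ _+_ (cong (_* y (suc (suc n))) (ℤP.*-identityˡ (x 0)))
                   (∑-cong n λ i i≤n → cong (λ t → + (suc n C suc i) * x (suc i) * y t) (sym (ℕP.+-∸-assoc 1 i≤n))) ⟩
        x 0 * y (suc (suc n)) + ∑[ i ≤ n ] (+ (suc n C suc i) * x (suc i) * y (suc n ∸ i))
      ≡⟨ cong (λ t → x 0 * y (suc (suc n)) + t) (sym (trans (cong (λ t → tail + t) last≡0) (ℤP.+-identityʳ tail))) ⟩
        x 0 * y (suc (suc n)) + ∑[ i ≤ suc n ] (+ (suc n C suc i) * x (suc i) * y (suc n ∸ i))
      ∎
      where
      open ≡-Reasoning
      tail = ∑[ i ≤ n ] (+ (suc n C suc i) * x (suc i) * y (suc n ∸ i))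
      last≡0 : + (suc n C suc (suc n)) * x (suc (suc n)) * y (suc n ∸ suc n) ≡ + 0
      last≡0 rewrite k>n⇒nCk≡0 (ℕP.n<1+n (suc n)) = zeroˡ² (x (suc (suc n))) (y (suc n ∸ suc n))

    binomialSum-suc : ∀ x y n → binomialSum x y (suc n) ≡ binomialSum (shift x) y n + binomialSum x (shift y) n
    binomialSum-suc x y n = begin
        ∑[ i ≤ suc n ] (+ (suc n C i) * x i * y (suc n ∸ i))
      ≡⟨ ∑-head n _ ⟩
        + 1 * x 0 * y (suc n) + ∑[ i ≤ n ] (+ (suc n C suc i) * x (suc i) * y (n ∸ i))
      ≡⟨ cong₂ _+_ (cong (_* y (suc n)) (ℤP.*-identityˡ (x 0))) (∑-cong n λ i _ → pascal i) ⟩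
        x 0 * y (suc n) + ∑[ i ≤ n ] (+ (n C i) * x (suc i) * y (n ∸ i) + + (n C suc i) * x (suc i) * y (n ∸ i))
      ≡⟨ cong (λ t → x 0 * y (suc n) + t) (∑-distrib-+ n (λ i → + (n C i) * x (suc i) * y (n ∸ i)) _) ⟩
        x 0 * y (suc n) + (binomialSum (shift x) y n + tail)
      ≡⟨ +-CS.x∙yz≈y∙xz (x 0 * y (suc n)) (binomialSum (shift x) y n) tail ⟩
        binomialSum (shift x) y n + (x 0 * y (suc n) + tail)
      ≡⟨ cong (λ t → binomialSum (shift x) y n + t) (sym (binomialSum-shiftʳ x y n)) ⟩
        binomialSum (shift x) y n + binomialSum x (shift y) n
      ∎
      where
      open ≡-Reasoning
      tail = ∑[ i ≤ n ] (+ (n C suc i) * x (suc i) * y (n ∸ i))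
      pascal : ∀ i → + (suc n C suc i) * x (suc i) * y (n ∸ i)
                   ≡ + (n C i) * x (suc i) * y (n ∸ i) + + (n C suc i) * x (suc i) * y (n ∸ i)
      pascal i rewrite sym (nCk+nC[k+1]≡[n+1]C[k+1] n i) | ℤP.pos-+ (n C i) (n C suc i) =
        trans (cong (_* y (n ∸ i)) (ℤP.*-distribʳ-+ (x (suc i)) (+ (n C i)) (+ (n C suc i))))
              (ℤP.*-distribʳ-+ (y (n ∸ i)) (+ (n C i) * x (suc i)) (+ (n C suc i) * x (suc i)))

  ⋆-binomial : ∀ x y → x ⋆ y ≗ binomialSum x y
  ⋆-binomial x y zero    = sym (cong (_* y 0) (ℤP.*-identityˡ (x 0)))
  ⋆-binomial x y (suc n) =
    trans (cong₂ _+_ (⋆-binomial (shift x) y n) (⋆-binomial x (shift y) n)) (sym (binomialSum-suc x y n))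

  infixr 9 _^⋆_ _^[_]

  _^⋆_ : Seq → ℕ → Seq
  x ^⋆ zero  = δ 0
  x ^⋆ suc m = x ^⋆ m ⋆ x

  -- The divided power xᵐ/m! (when x 0 = 0, see ^⋆≗!·^[]), defined without division
  -- through its derivative (x^[m+1])′ = x′ ⋆ x^[m].
  _^[_] : Seq → ℕ → Seq
  (x ^[ zero  ])         = δ 0
  (x ^[ suc m ]) zero    = + 0
  (x ^[ suc m ]) (suc n) = (shift x ⋆ x ^[ m ]) n

  ^[]-cong : ∀ {x y} → x ≗ y → ∀ m → x ^[ m ] ≗ y ^[ m ]
  ^[]-cong x≗y zero    n       = refl
  ^[]-cong x≗y (suc m) zero    = refl
  ^[]-cong x≗y (suc m) (suc n) = ⋆-cong (x≗y ∘ suc) (^[]-cong x≗y m) n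

  ^[]-suc : ∀ x → x 0 ≡ + 0 → ∀ m n → + (suc m) * (x ^[ suc m ]) n ≡ (x ^[ m ] ⋆ x) n
  ^[]-suc x x₀≡0 m       zero    =
    trans (ℤP.*-zeroʳ (+ suc m)) (sym (trans (cong ((x ^[ m ]) 0 *_) x₀≡0) (ℤP.*-zeroʳ ((x ^[ m ]) 0))))
  ^[]-suc x x₀≡0 zero    (suc n) = begin
      + 1 * (shift x ⋆ δ 0) n              ≡⟨ ℤP.*-identityˡ _ ⟩
      (shift x ⋆ δ 0) n                    ≡⟨ ⋆-comm (shift x) (δ 0) n ⟩
      (δ 0 ⋆ shift x) n                    ≡⟨ ℤP.+-identityˡ _ ⟨
      + 0 + (δ 0 ⋆ shift x) n              ≡⟨ cong (_+ (δ 0 ⋆ shift x) n) (⋆-zeroˡ x n) ⟨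
      (𝟘 ⋆ x) n + (δ 0 ⋆ shift x) n        ∎
    where open ≡-Reasoning
  ^[]-suc x x₀≡0 (suc m) (suc n) = begin
      + (2 ℕ.+ m) * (shift x ⋆ x ^[ suc m ]) n
    ≡⟨ ℤP.*-distribʳ-+ _ (+ 1) (+ suc m) ⟩
      + 1 * (shift x ⋆ x ^[ suc m ]) n + + (suc m) * (shift x ⋆ x ^[ suc m ]) n
    ≡⟨ cong₂ _+_ (trans (ℤP.*-identityˡ _) (⋆-comm (shift x) (x ^[ suc m ]) n))
                 (sym (⋆-scaleʳ (+ suc m) (shift x) (x ^[ suc m ]) n)) ⟩
      (x ^[ suc m ] ⋆ shift x) n + (shift x ⋆ (+ suc m) · x ^[ suc m ]) n
    ≡⟨ cong (λ t → (x ^[ suc m ] ⋆ shift x) n + t) (⋆-cong (λ _ → refl) (^[]-suc x x₀≡0 m) n) ⟩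
      (x ^[ suc m ] ⋆ shift x) n + (shift x ⋆ (x ^[ m ] ⋆ x)) n
    ≡⟨ cong (λ t → (x ^[ suc m ] ⋆ shift x) n + t) (sym (⋆-assoc (shift x) (x ^[ m ]) x n)) ⟩
      (x ^[ suc m ] ⋆ shift x) n + (shift x ⋆ x ^[ m ] ⋆ x) n
    ≡⟨ ℤP.+-comm ((x ^[ suc m ] ⋆ shift x) n) ((shift x ⋆ x ^[ m ] ⋆ x) n) ⟩
      (x ^[ suc m ] ⋆ x) (suc n)
    ∎
    where open ≡-Reasoning

  ^⋆≗!·^[] : ∀ x → x 0 ≡ + 0 → ∀ m → x ^⋆ m ≗ (+ (m !)) · x ^[ m ]
  ^⋆≗!·^[] x x₀≡0 zero    n = sym (ℤP.*-identityˡ _)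
  ^⋆≗!·^[] x x₀≡0 (suc m) n = begin
      (x ^⋆ m ⋆ x) n                               ≡⟨ ⋆-cong (^⋆≗!·^[] x x₀≡0 m) (λ _ → refl) n ⟩
      ((+ (m !)) · x ^[ m ] ⋆ x) n                   ≡⟨ ⋆-scaleˡ (+ (m !)) (x ^[ m ]) x n ⟩
      + (m !) * (x ^[ m ] ⋆ x) n                   ≡⟨ cong (+ (m !) *_) (^[]-suc x x₀≡0 m n) ⟨
      + (m !) * (+ (suc m) * (x ^[ suc m ]) n)     ≡⟨ ℤP.*-assoc (+ (m !)) _ _ ⟨
      + (m !) * + (suc m) * (x ^[ suc m ]) n       ≡⟨ cong (_* (x ^[ suc m ]) n) (sym (ℤP.pos-* (m !) (suc m))) ⟩
      + (m ! ℕ.* suc m) * (x ^[ suc m ]) n         ≡⟨ cong (λ c → + c * (x ^[ suc m ]) n) (ℕP.*-comm (m !) (suc m)) ⟩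
      + (suc m !) * (x ^[ suc m ]) n               ∎
    where open ≡-Reasoning

  ^[]-⊕ : ∀ a b m → (a ⊕ b) ^[ m ] ≗ λ n → ∑[ j ≤ m ] (a ^[ m ∸ j ] ⋆ b ^[ j ]) n
  ^[]-⊕ a b zero    n       = sym (⋆-identityʳ (δ 0) n)
  ^[]-⊕ a b (suc m) zero    = sym (∑-zero (suc m) vanish)
    where
    vanish : ∀ j → j ≤ suc m → (a ^[ suc m ∸ j ] ⋆ b ^[ j ]) 0 ≡ + 0
    vanish zero    _ = ℤP.*-zeroˡ ((b ^[ 0 ]) 0)
    vanish (suc j) _ = ℤP.*-zeroʳ ((a ^[ m ∸ j ]) 0)
  ^[]-⊕ a b (suc m) (suc n) = begin
      ((shift a ⊕ shift b) ⋆ (a ⊕ b) ^[ m ]) n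
    ≡⟨ ⋆-cong (λ _ → refl) (^[]-⊕ a b m) n ⟩
      ((shift a ⊕ shift b) ⋆ terms m) n
    ≡⟨ ⋆-distribʳ-⊕ (shift a) (shift b) (terms m) n ⟩
      (shift a ⋆ terms m) n + (shift b ⋆ terms m) n
    ≡⟨ cong₂ _+_ (⋆-∑ (shift a) m (λ j → a ^[ m ∸ j ] ⋆ b ^[ j ]) n)
                 (⋆-∑ (shift b) m (λ j → a ^[ m ∸ j ] ⋆ b ^[ j ]) n) ⟩
      ∑[ j ≤ m ] (shift a ⋆ (a ^[ m ∸ j ] ⋆ b ^[ j ])) n + ∑[ j ≤ m ] (shift b ⋆ (a ^[ m ∸ j ] ⋆ b ^[ j ])) n
    ≡⟨ cong₂ _+_ (sym differentiate-a) (sym differentiate-b) ⟩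
      ∑[ j ≤ suc m ] (shift (a ^[ suc m ∸ j ]) ⋆ b ^[ j ]) n + ∑[ j ≤ suc m ] (a ^[ suc m ∸ j ] ⋆ shift (b ^[ j ])) n
    ≡⟨ sym (∑-distrib-+ (suc m) (λ j → (shift (a ^[ suc m ∸ j ]) ⋆ b ^[ j ]) n) _) ⟩
      ∑[ j ≤ suc m ] ((a ^[ suc m ∸ j ] ⋆ b ^[ j ]) (suc n))
    ∎
    where
    open ≡-Reasoning
    terms : ℕ → Seq
    terms m n = ∑[ j ≤ m ] (a ^[ m ∸ j ] ⋆ b ^[ j ]) n
    differentiate-a : ∑[ j ≤ suc m ] (shift (a ^[ suc m ∸ j ]) ⋆ b ^[ j ]) n
                    ≡ ∑[ j ≤ m ] (shift a ⋆ (a ^[ m ∸ j ] ⋆ b ^[ j ])) n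
    differentiate-a = begin
        ∑[ j ≤ m ] (shift (a ^[ suc m ∸ j ]) ⋆ b ^[ j ]) n + (shift (a ^[ suc m ∸ suc m ]) ⋆ b ^[ suc m ]) n
      ≡⟨ cong (λ t → ∑[ j ≤ m ] (shift (a ^[ suc m ∸ j ]) ⋆ b ^[ j ]) n + t)
              (trans (cong (λ i → (shift (a ^[ i ]) ⋆ b ^[ suc m ]) n) (ℕP.n∸n≡0 m)) (⋆-zeroˡ (b ^[ suc m ]) n)) ⟩
        ∑[ j ≤ m ] (shift (a ^[ suc m ∸ j ]) ⋆ b ^[ j ]) n + + 0
      ≡⟨ ℤP.+-identityʳ _ ⟩
        ∑[ j ≤ m ] (shift (a ^[ suc m ∸ j ]) ⋆ b ^[ j ]) n
      ≡⟨ ∑-cong m (λ j j≤m → trans (cong (λ i → (shift (a ^[ i ]) ⋆ b ^[ j ]) n) (ℕP.+-∸-assoc 1 j≤m))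
                                   (⋆-assoc (shift a) (a ^[ m ∸ j ]) (b ^[ j ]) n)) ⟩
        ∑[ j ≤ m ] (shift a ⋆ (a ^[ m ∸ j ] ⋆ b ^[ j ])) n
      ∎
    ⋆-leftComm : ∀ y z → (y ⋆ (shift b ⋆ z)) n ≡ (shift b ⋆ (y ⋆ z)) n
    ⋆-leftComm y z = begin
        (y ⋆ (shift b ⋆ z)) n   ≡⟨ ⋆-assoc y (shift b) z n ⟨
        (y ⋆ shift b ⋆ z) n     ≡⟨ ⋆-cong (⋆-comm y (shift b)) (λ _ → refl) n ⟩
        (shift b ⋆ y ⋆ z) n     ≡⟨ ⋆-assoc (shift b) y z n ⟩
        (shift b ⋆ (y ⋆ z)) n   ∎
    differentiate-b : ∑[ j ≤ suc m ] (a ^[ suc m ∸ j ] ⋆ shift (b ^[ j ])) n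
                    ≡ ∑[ j ≤ m ] (shift b ⋆ (a ^[ m ∸ j ] ⋆ b ^[ j ])) n
    differentiate-b = begin
        ∑[ j ≤ suc m ] (a ^[ suc m ∸ j ] ⋆ shift (b ^[ j ])) n
      ≡⟨ ∑-head m _ ⟩
        (a ^[ suc m ] ⋆ 𝟘) n + ∑[ j ≤ m ] (a ^[ m ∸ j ] ⋆ (shift b ⋆ b ^[ j ])) n
      ≡⟨ cong (_+ ∑[ j ≤ m ] (a ^[ m ∸ j ] ⋆ (shift b ⋆ b ^[ j ])) n) (⋆-zeroʳ (a ^[ suc m ]) n) ⟩
        + 0 + ∑[ j ≤ m ] (a ^[ m ∸ j ] ⋆ (shift b ⋆ b ^[ j ])) n
      ≡⟨ ℤP.+-identityˡ _ ⟩
        ∑[ j ≤ m ] (a ^[ m ∸ j ] ⋆ (shift b ⋆ b ^[ j ])) n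
      ≡⟨ ∑-cong m (λ j _ → ⋆-leftComm (a ^[ m ∸ j ]) (b ^[ j ])) ⟩
        ∑[ j ≤ m ] (shift b ⋆ (a ^[ m ∸ j ] ⋆ b ^[ j ])) n
      ∎

  -- The number of partitions of an l(d+1)-set into blocks of size d+1: a fixed element picks its
  -- d block-mates among the other d + l(d+1) elements.
  blockPartitions : ℕ → ℕ → ℕ
  blockPartitions d zero    = 1
  blockPartitions d (suc l) = blockPartitions d l ℕ.* ((d ℕ.+ l ℕ.* suc d) C d)

  blockPartitions-singletons : ∀ l → blockPartitions 0 l ≡ 1
  blockPartitions-singletons zero    = refl
  blockPartitions-singletons (suc l) = cong (ℕ._* 1) (blockPartitions-singletons l)

  private
    C-δ : ∀ n d M → + (n C d) * δ M (n ∸ d) ≡ + ((d ℕ.+ M) C d) * δ (d ℕ.+ M) n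
    C-δ n d M with n ℕ.≟ d ℕ.+ M
    ... | yes refl rewrite ℕP.m+n∸m≡n d M | δ-diag M | δ-diag (d ℕ.+ M) = refl
    ... | no n≢d+M = trans lhs≡0 (sym rhs≡0)
      where
      rhs≡0 : + ((d ℕ.+ M) C d) * δ (d ℕ.+ M) n ≡ + 0
      rhs≡0 rewrite δ-off (d ℕ.+ M) n (n≢d+M ∘ sym) = ℤP.*-zeroʳ (+ ((d ℕ.+ M) C d))
      lhs≡0 : + (n C d) * δ M (n ∸ d) ≡ + 0
      lhs≡0 with d ℕ.≤? n
      ... | yes d≤n
        rewrite δ-off M (n ∸ d) (λ M≡n-d → n≢d+M (trans (sym (ℕP.m+[n∸m]≡n d≤n)) (cong (d ℕ.+_) (sym M≡n-d))))
                  = ℤP.*-zeroʳ (+ (n C d))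
      ... | no  d≰n rewrite k>n⇒nCk≡0 (ℕP.≰⇒> d≰n) = ℤP.*-zeroˡ (δ M (n ∸ d))

  δ-^[] : ∀ d l → δ (suc d) ^[ l ] ≗ (+ blockPartitions d l) · δ (l ℕ.* suc d)
  δ-^[] d zero    n       = sym (ℤP.*-identityˡ _)
  δ-^[] d (suc l) zero    = sym (ℤP.*-zeroʳ (+ blockPartitions d (suc l)))
  δ-^[] d (suc l) (suc n) = begin
      (δ d ⋆ δ (suc d) ^[ l ]) n
    ≡⟨ δ-⋆ d (δ (suc d) ^[ l ]) n ⟩
      + (n C d) * (δ (suc d) ^[ l ]) (n ∸ d)
    ≡⟨ cong (+ (n C d) *_) (δ-^[] d l (n ∸ d)) ⟩
      + (n C d) * (+ blockPartitions d l * δ (l ℕ.* suc d) (n ∸ d))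
    ≡⟨ *-CS.x∙yz≈y∙xz (+ (n C d)) (+ blockPartitions d l) _ ⟩
      + blockPartitions d l * (+ (n C d) * δ (l ℕ.* suc d) (n ∸ d))
    ≡⟨ cong (+ blockPartitions d l *_) (C-δ n d (l ℕ.* suc d)) ⟩
      + blockPartitions d l * (+ ((d ℕ.+ l ℕ.* suc d) C d) * δ (d ℕ.+ l ℕ.* suc d) n)
    ≡⟨ ℤP.*-assoc (+ blockPartitions d l) _ _ ⟨
      + blockPartitions d l * + ((d ℕ.+ l ℕ.* suc d) C d) * δ (d ℕ.+ l ℕ.* suc d) n
    ≡⟨ cong (_* δ (d ℕ.+ l ℕ.* suc d) n) (ℤP.pos-* (blockPartitions d l) _) ⟨
      + blockPartitions d (suc l) * δ (d ℕ.+ l ℕ.* suc d) n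
    ∎
    where open ≡-Reasoning

  δ₁-^[] : ∀ m → δ 1 ^[ m ] ≗ δ m
  δ₁-^[] m n = begin
      (δ 1 ^[ m ]) n                          ≡⟨ δ-^[] 0 m n ⟩
      + blockPartitions 0 m * δ (m ℕ.* 1) n   ≡⟨ cong₂ (λ c i → + c * δ i n) (blockPartitions-singletons m) (ℕP.*-identityʳ m) ⟩
      + 1 * δ m n                             ≡⟨ ℤP.*-identityˡ (δ m n) ⟩
      δ m n                                   ∎
    where open ≡-Reasoning

module Congruence where

  open import Data.Integer using (_+_; _*_; _-_; -_)
  open import Data.Integer.Divisibility.Signed using (_∣_; divides; ∣m∣n⇒∣m+n; ∣m⇒∣-m; ∣n⇒∣m*n)
  open ExponentialSeries

  -- A record rather than a definition, so that a and b can be inferred from a ≡ b [mod m ].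
  record Congruent (m a b : ℤ) : Set where
    constructor congruent
    field ∣-difference : m ∣ a - b

  open Congruent public

  infix 4 Congruent
  syntax Congruent m a b = a ≡ b [mod m ]

  private
    variable
      m a b c d : ℤ

  ≡⇒≡-mod : a ≡ b → a ≡ b [mod m ]
  ≡⇒≡-mod {a} {m = m} refl = congruent (divides (+ 0) (trans (ℤP.+-inverseʳ a) (sym (ℤP.*-zeroˡ m))))

  ∣⇒≡0-mod : m ∣ a → a ≡ + 0 [mod m ]
  ∣⇒≡0-mod {m} {a} = congruent ∘ subst (m ∣_) (sym (ℤP.+-identityʳ a))

  ≡-mod-sym : a ≡ b [mod m ] → b ≡ a [mod m ]
  ≡-mod-sym {a} {b} {m} (congruent a≡b) = congruent (subst (m ∣_) (negate a b) (∣m⇒∣-m a≡b))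
    where
    negate : ∀ a b → - (a - b) ≡ b - a
    negate = solve-∀

  ≡-mod-trans : a ≡ b [mod m ] → b ≡ c [mod m ] → a ≡ c [mod m ]
  ≡-mod-trans {a} {b} {m} {c} (congruent a≡b) (congruent b≡c) =
    congruent (subst (m ∣_) (telescope a b c) (∣m∣n⇒∣m+n a≡b b≡c))
    where
    telescope : ∀ a b c → (a - b) + (b - c) ≡ a - c
    telescope = solve-∀

  +-cong-mod : a ≡ b [mod m ] → c ≡ d [mod m ] → a + c ≡ b + d [mod m ]
  +-cong-mod {a} {b} {m} {c} {d} (congruent a≡b) (congruent c≡d) =
    congruent (subst (m ∣_) (regroup a b c d) (∣m∣n⇒∣m+n a≡b c≡d))
    where
    regroup : ∀ a b c d → (a - b) + (c - d) ≡ (a + c) - (b + d)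
    regroup = solve-∀

  *-cong-mod : a ≡ b [mod m ] → c ≡ d [mod m ] → a * c ≡ b * d [mod m ]
  *-cong-mod {a} {b} {m} {c} {d} (congruent a≡b) (congruent c≡d) =
    congruent (subst (m ∣_) (regroup a b c d) (∣m∣n⇒∣m+n (∣n⇒∣m*n c a≡b) (∣n⇒∣m*n b c≡d)))
    where
    regroup : ∀ a b c d → c * (a - b) + b * (c - d) ≡ a * c - b * d
    regroup = solve-∀

  ⋆-cong-mod : ∀ {x x′ y y′} → (∀ n → x n ≡ x′ n [mod m ]) → (∀ n → y n ≡ y′ n [mod m ]) →
               ∀ n → (x ⋆ y) n ≡ (x′ ⋆ y′) n [mod m ]
  ⋆-cong-mod x≡x′ y≡y′ zero    = *-cong-mod (x≡x′ 0) (y≡y′ 0)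
  ⋆-cong-mod x≡x′ y≡y′ (suc n) =
    +-cong-mod (⋆-cong-mod (x≡x′ ∘ suc) y≡y′ n) (⋆-cong-mod x≡x′ (y≡y′ ∘ suc) n)

  ^[]-cong-mod : ∀ {x y} → (∀ n → x n ≡ y n [mod m ]) → ∀ k n → (x ^[ k ]) n ≡ (y ^[ k ]) n [mod m ]
  ^[]-cong-mod x≡y zero    n       = ≡⇒≡-mod refl
  ^[]-cong-mod x≡y (suc k) zero    = ≡⇒≡-mod refl
  ^[]-cong-mod x≡y (suc k) (suc n) = ⋆-cong-mod (x≡y ∘ suc) (^[]-cong-mod x≡y k) n

  ∑≡first-two-mod : ∀ (h : ℕ → ℤ) → (∀ j → m ∣ h (2 ℕ.+ j)) → ∀ k → ∑≤ (suc k) h ≡ h 0 + h 1 [mod m ]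
  ∑≡first-two-mod h m∣h zero    = ≡⇒≡-mod refl
  ∑≡first-two-mod {m} h m∣h (suc k) = congruent (subst (m ∣_) (regroup (∑≤ (suc k) h) (h 0 + h 1) (h (2 ℕ.+ k)))
    (∣m∣n⇒∣m+n (∣-difference (∑≡first-two-mod h m∣h k)) (m∣h k)))
    where
    regroup : ∀ a b c → (a - b) + c ≡ (a + c) - b
    regroup = solve-∀

module Recurrence where

  open import Data.Integer using (_+_; _*_; _-_)
  open import Data.Integer.Divisibility.Signed
    using (_∣_; divides; ∣m∣n⇒∣m+n; ∣m∣n⇒∣m-n; ∣n⇒∣m*n; ∣m⇒∣m*n; ∣ᵤ⇒∣)
  import Data.Nat.Divisibility as ℕ∣
  import Data.Nat.DivMod as ℕD
  import Data.Nat.Tactic.RingSolver as ℕSolver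
  open import Data.Fin as Fin using (Fin; toℕ; fromℕ; inject₁; lower₁)
  import Data.Fin.Properties as FinP
  open import Data.Vec using (Vec; []; _∷_; _∷ʳ_; lookup)
  open ExponentialSeries
  open Congruence

  lookup-∷ʳ-fromℕ : ∀ {A : Set} {n} (xs : Vec A n) x → lookup (xs ∷ʳ x) (fromℕ n) ≡ x
  lookup-∷ʳ-fromℕ []       x = refl
  lookup-∷ʳ-fromℕ (y ∷ xs) x = lookup-∷ʳ-fromℕ xs x

  lookup-∷ʳ-inject₁ : ∀ {A : Set} {n} (xs : Vec A n) x (i : Fin n) → lookup (xs ∷ʳ x) (inject₁ i) ≡ lookup xs i
  lookup-∷ʳ-inject₁ (y ∷ xs) x Fin.zero    = refl
  lookup-∷ʳ-inject₁ (y ∷ xs) x (Fin.suc i) = lookup-∷ʳ-inject₁ xs x i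

  lookup-uVec : ∀ n (i : Fin n) → lookup (uVec n) i ≡ u (toℕ i)
  lookup-uVec (suc n) i with n ℕ.≟ toℕ i
  ... | yes n≡i = trans (cong (lookup (uVec (suc n))) i≡last) (cong u n≡i)
    where
    i≡last : i ≡ fromℕ n
    i≡last = FinP.toℕ-injective (trans (sym n≡i) (sym (FinP.toℕ-fromℕ n)))
  ... | no  n≢i = begin
      lookup (uVec (suc n)) i                     ≡⟨ cong (lookup (uVec (suc n))) (FinP.inject₁-lower₁ i n≢i) ⟨
      lookup (uVec (suc n)) (inject₁ (lower₁ i n≢i)) ≡⟨ lookup-∷ʳ-inject₁ (uVec n) _ (lower₁ i n≢i) ⟩
      lookup (uVec n) (lower₁ i n≢i)              ≡⟨ lookup-uVec n (lower₁ i n≢i) ⟩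
      u (toℕ (lower₁ i n≢i))                      ≡⟨ cong u (FinP.toℕ-lower₁ i n≢i) ⟩
      u (toℕ i)                                   ∎
    where open ≡-Reasoning

  sumFin-cong : ∀ n {f g : Fin n → ℤ} → (∀ i → f i ≡ g i) → sumFin n f ≡ sumFin n g
  sumFin-cong zero    f≗g = refl
  sumFin-cong (suc n) f≗g = cong₂ _+_ (f≗g Fin.zero) (sumFin-cong n (f≗g ∘ Fin.suc))

  ∣-sumFin : ∀ {m} n (f : Fin n → ℤ) → (∀ i → m ∣ f i) → m ∣ sumFin n f
  ∣-sumFin {m} zero f m∣f = divides (+ 0) (sym (ℤP.*-zeroˡ m))
  ∣-sumFin (suc n) f m∣f = ∣m∣n⇒∣m+n (m∣f Fin.zero) (∣-sumFin n (f ∘ Fin.suc) (m∣f ∘ Fin.suc))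

  -- `_C_` binds more loosely than `_*_`, so the coefficient in uStep is C(2n+1, (2m+1)·Q(n−m)²)
  -- rather than C(2n+1, 2m+1)·Q(n−m)²; it vanishes as soon as n − m ≥ 2.
  uCoefficient : ℕ → ℕ → ℕ
  uCoefficient n m = (2 ℕ.* n ℕ.+ 1) C (2 ℕ.* m ℕ.+ 1) ℕ.* Q (n ∸ m) ℕ.^ 2

  u-suc : ∀ n → u (suc n) ≡ + (P (suc n) ℕ.^ 2) - sumFin (suc n) (λ m → + uCoefficient (suc n) (toℕ m) * u (toℕ m))
  u-suc n = trans (lookup-∷ʳ-fromℕ (uVec (suc n)) _) (cong (λ t → + (P (suc n) ℕ.^ 2) - t)
    (sumFin-cong (suc n) λ m → cong (λ v → + uCoefficient (suc n) (toℕ m) * v) (lookup-uVec (suc n) m)))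

  private
    4[1+j]∸3≡1+4j : ∀ j → 4 ℕ.* suc j ∸ 3 ≡ suc (4 ℕ.* j)
    4[1+j]∸3≡1+4j j = trans (cong (_∸ 3) (expand j)) (ℕP.m+n∸m≡n 3 (suc (4 ℕ.* j)))
      where
      expand : ∀ j → 4 ℕ.* suc j ≡ 3 ℕ.+ suc (4 ℕ.* j)
      expand = ℕSolver.solve-∀

    Q-positive : ∀ n → 1 ≤ Q n
    Q-positive zero    = ℕP.≤-refl
    Q-positive (suc n) rewrite 4[1+j]∸3≡1+4j n = ℕP.*-mono-≤ (Q-positive n) (s≤s z≤n)

    1+4[1+s]≤Q[2+s] : ∀ s → suc (4 ℕ.* suc s) ≤ Q (2 ℕ.+ s)
    1+4[1+s]≤Q[2+s] s rewrite 4[1+j]∸3≡1+4j (suc s) = ℕP.m≤n*m _ (Q (suc s)) {{ℕ.>-nonZero (Q-positive (suc s))}}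

    uCoefficient-index-large : ∀ m s → 2 ℕ.* (m ℕ.+ (2 ℕ.+ s)) ℕ.+ 1 < (2 ℕ.* m ℕ.+ 1) ℕ.* Q (2 ℕ.+ s) ℕ.^ 2
    uCoefficient-index-large m s = begin-strict
        2 ℕ.* (m ℕ.+ (2 ℕ.+ s)) ℕ.+ 1
      <⟨ ℕP.m<m+n _ (s≤s z≤n) ⟩
        2 ℕ.* (m ℕ.+ (2 ℕ.+ s)) ℕ.+ 1
          ℕ.+ suc (19 ℕ.+ 48 ℕ.* m ℕ.+ 38 ℕ.* s ℕ.+ 80 ℕ.* m ℕ.* s ℕ.+ 16 ℕ.* s ℕ.* s ℕ.+ 32 ℕ.* m ℕ.* s ℕ.* s)
      ≡⟨ expand m s ⟩
        (2 ℕ.* m ℕ.+ 1) ℕ.* (suc (4 ℕ.* suc s) ℕ.* suc (4 ℕ.* suc s))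
      ≤⟨ ℕP.*-monoʳ-≤ (2 ℕ.* m ℕ.+ 1) (ℕP.*-mono-≤ (1+4[1+s]≤Q[2+s] s) (1+4[1+s]≤Q[2+s] s)) ⟩
        (2 ℕ.* m ℕ.+ 1) ℕ.* (Q (2 ℕ.+ s) ℕ.* Q (2 ℕ.+ s))
      ≡⟨ cong (λ q → (2 ℕ.* m ℕ.+ 1) ℕ.* (Q (2 ℕ.+ s) ℕ.* q)) (ℕP.*-identityʳ (Q (2 ℕ.+ s))) ⟨
        (2 ℕ.* m ℕ.+ 1) ℕ.* Q (2 ℕ.+ s) ℕ.^ 2
      ∎
      where
      open ℕP.≤-Reasoning
      expand : ∀ m s → 2 ℕ.* (m ℕ.+ (2 ℕ.+ s)) ℕ.+ 1
                       ℕ.+ suc (19 ℕ.+ 48 ℕ.* m ℕ.+ 38 ℕ.* s ℕ.+ 80 ℕ.* m ℕ.* s ℕ.+ 16 ℕ.* s ℕ.* s ℕ.+ 32 ℕ.* m ℕ.* s ℕ.* s)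
                     ≡ (2 ℕ.* m ℕ.+ 1) ℕ.* (suc (4 ℕ.* suc s) ℕ.* suc (4 ℕ.* suc s))
      expand = ℕSolver.solve-∀

  uCoefficient-vanishes : ∀ {n m} → 2 ℕ.+ m ≤ n → uCoefficient n m ≡ 0
  uCoefficient-vanishes {n} {m} 2+m≤n =
    k>n⇒nCk≡0 (subst₂ (λ n d → 2 ℕ.* n ℕ.+ 1 < (2 ℕ.* m ℕ.+ 1) ℕ.* Q d ℕ.^ 2) n≡ d≡ (uCoefficient-index-large m s))
    where
    s = n ∸ (2 ℕ.+ m)
    n≡ : m ℕ.+ (2 ℕ.+ s) ≡ n
    n≡ = trans (ℕP.+-suc m (suc s)) (trans (cong suc (ℕP.+-suc m s)) (ℕP.m+[n∸m]≡n 2+m≤n))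
    d≡ : 2 ℕ.+ s ≡ n ∸ m
    d≡ = trans (sym (ℕP.m+n∸m≡n m (2 ℕ.+ s))) (cong (_∸ m) n≡)

  5∣P : ∀ t → 5 ℕ∣.∣ P (4 ℕ.+ t)
  5∣P zero    = ℕ∣.divides 693 refl
  5∣P (suc t) = ℕ∣.∣m⇒∣m*n _ (5∣P t)

  5∣P² : ∀ t → + 5 ∣ + (P (4 ℕ.+ t) ℕ.^ 2)
  5∣P² t = square (5∣P t)
    where
    square : ∀ {x} → 5 ℕ∣.∣ x → + 5 ∣ + (x ℕ.^ 2)
    square {x} 5∣x = ∣ᵤ⇒∣ (ℕ∣.∣m⇒∣m*n (x ℕ.^ 1) 5∣x)

  -- u 3 = 45360.
  5∣u : ∀ t → + 5 ∣ u (3 ℕ.+ t)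
  5∣u zero    = divides (+ 9072) refl
  5∣u (suc t) = subst (+ 5 ∣_) (sym (u-suc (3 ℕ.+ t)))
    (∣m∣n⇒∣m-n (5∣P² t) (∣-sumFin (4 ℕ.+ t) (λ m → + uCoefficient (4 ℕ.+ t) (toℕ m) * u (toℕ m)) term))
    where
    term : ∀ (m : Fin (4 ℕ.+ t)) → + 5 ∣ + uCoefficient (4 ℕ.+ t) (toℕ m) * u (toℕ m)
    term m with toℕ m ℕ.≟ 3 ℕ.+ t
    ... | yes m≡3+t = ∣n⇒∣m*n (+ uCoefficient (4 ℕ.+ t) (toℕ m)) (subst (λ j → + 5 ∣ u j) (sym m≡3+t) (5∣u t))
    ... | no  m≢3+t = subst (λ c → + 5 ∣ + c * u (toℕ m))
      (sym (uCoefficient-vanishes (s≤s (ℕP.≤∧≢⇒< (ℕP.≤-pred (FinP.toℕ<n m)) m≢3+t))))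
      (∣m⇒∣m*n (u (toℕ m)) (divides (+ 0) refl))

  F-coeff : Seq
  F-coeff N with N ℕ.% 2 ℕ.≟ 1
  ... | yes _ = u (N ℕ./ 2)
  ... | no  _ = + 0

  G : Seq
  G = δ 1 ⊕ δ 5 ⊕ δ 3

  -- u 0 = 1, u 1 = 6 and u 2 = 381.
  F-coeff≡G : ∀ N → F-coeff N ≡ G N [mod + 5 ]
  F-coeff≡G 0 = ≡⇒≡-mod refl
  F-coeff≡G 1 = ≡⇒≡-mod refl
  F-coeff≡G 2 = ≡⇒≡-mod refl
  F-coeff≡G 3 = congruent (divides (+ 1) refl)
  F-coeff≡G 4 = ≡⇒≡-mod refl
  F-coeff≡G 5 = congruent (divides (+ 76) refl)
  F-coeff≡G 6 = ≡⇒≡-mod refl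
  F-coeff≡G N@(suc (suc (suc (suc (suc (suc (suc t))))))) with N ℕ.% 2 ℕ.≟ 1
  ... | yes _ = ∣⇒≡0-mod (subst (λ j → + 5 ∣ u j) (ℕP.m+[n∸m]≡n 3≤N/2) (5∣u (N ℕ./ 2 ∸ 3)))
    where
    3≤N/2 : 3 ≤ N ℕ./ 2
    3≤N/2 = ℕD./-monoˡ-≤ 2 (ℕP.m≤m+n 6 (suc t))
  ... | no  _ = ≡⇒≡-mod refl

module ReducedSeries where

  open import Data.Integer using (_+_; _*_)
  open import Data.Integer.Divisibility.Signed using (_∣_; ∣ᵤ⇒∣; ∣m⇒∣m*n)
  import Data.Nat.Divisibility as ℕ∣
  import Data.Nat.Tactic.RingSolver as ℕSolver
  open ExponentialSeries
  open Congruence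
  open Recurrence using (G)

  A : Seq
  A = δ 1 ⊕ δ 5

  5∣blockPartitions-triples : ∀ j → 5 ℕ∣.∣ blockPartitions 2 (2 ℕ.+ j)
  5∣blockPartitions-triples zero    = ℕ∣.divides 2 refl
  5∣blockPartitions-triples (suc j) = ℕ∣.∣m⇒∣m*n _ (5∣blockPartitions-triples j)

  G^[1+m]≡A^[1+m]+δ₃⋆A^[m] : ∀ m n → (G ^[ suc m ]) n ≡ (A ^[ suc m ]) n + + (n C 3) * (A ^[ m ]) (n ∸ 3) [mod + 5 ]
  G^[1+m]≡A^[1+m]+δ₃⋆A^[m] m n = ≡-mod-trans (≡⇒≡-mod (^[]-⊕ A (δ 3) (suc m) n))
             (≡-mod-trans (∑≡first-two-mod term 5∣term m) (≡⇒≡-mod (cong₂ _+_ term₀ term₁)))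
    where
    term : ℕ → ℤ
    term j = (A ^[ suc m ∸ j ] ⋆ δ 3 ^[ j ]) n
    5∣term : ∀ j → + 5 ∣ term (2 ℕ.+ j)
    5∣term j = subst (+ 5 ∣_)
      (sym (trans (⋆-cong (λ _ → refl) (δ-^[] 2 (2 ℕ.+ j)) n) (⋆-scaleʳ c (A ^[ m ∸ suc j ]) (δ ((2 ℕ.+ j) ℕ.* 3)) n)))
      (∣m⇒∣m*n ((A ^[ m ∸ suc j ] ⋆ δ ((2 ℕ.+ j) ℕ.* 3)) n) (∣ᵤ⇒∣ {i = c} (5∣blockPartitions-triples j)))
      where
      c = + blockPartitions 2 (2 ℕ.+ j)
    term₀ : term 0 ≡ (A ^[ suc m ]) n
    term₀ = ⋆-identityʳ (A ^[ suc m ]) n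
    term₁ : term 1 ≡ + (n C 3) * (A ^[ m ]) (n ∸ 3)
    term₁ = trans (⋆-cong (λ _ → refl) (λ t → trans (δ-^[] 2 1 t) (ℤP.*-identityˡ (δ 3 t))) n)
                  (trans (⋆-comm (A ^[ m ]) (δ 3) n) (δ-⋆ 3 (A ^[ m ]) n))

  private
    A-term : ℕ → ℕ → ℕ → ℤ
    A-term m N l = + blockPartitions 4 l * (+ (N C (m ∸ l)) * δ (l ℕ.* 5) (N ∸ (m ∸ l)))

    A-term-index : ∀ {l m N} → l ≤ m → m ∸ l ≤ N → N ∸ (m ∸ l) ≡ l ℕ.* 5 → N ≡ m ℕ.+ l ℕ.* 4
    A-term-index {l} {m} {N} l≤m m-l≤N N-[m-l]≡5l = begin
        N                               ≡⟨ ℕP.m+[n∸m]≡n m-l≤N ⟨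
        m ∸ l ℕ.+ (N ∸ (m ∸ l))         ≡⟨ cong (m ∸ l ℕ.+_) N-[m-l]≡5l ⟩
        m ∸ l ℕ.+ l ℕ.* 5               ≡⟨ regroup (m ∸ l) l ⟩
        m ∸ l ℕ.+ l ℕ.+ l ℕ.* 4         ≡⟨ cong (ℕ._+ l ℕ.* 4) (ℕP.m∸n+n≡m l≤m) ⟩
        m ℕ.+ l ℕ.* 4                   ∎
      where
      open ≡-Reasoning
      regroup : ∀ x l → x ℕ.+ l ℕ.* 5 ≡ x ℕ.+ l ℕ.+ l ℕ.* 4
      regroup = ℕSolver.solve-∀

    A-term-off : ∀ m N l → l ≤ m → N ≢ m ℕ.+ l ℕ.* 4 → A-term m N l ≡ + 0
    A-term-off m N l l≤m N≢ with m ∸ l ℕ.≤? N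
    ... | yes m-l≤N rewrite δ-off (l ℕ.* 5) (N ∸ (m ∸ l)) (N≢ ∘ A-term-index l≤m m-l≤N ∘ sym) =
      trans (cong (+ blockPartitions 4 l *_) (ℤP.*-zeroʳ (+ (N C (m ∸ l))))) (ℤP.*-zeroʳ (+ blockPartitions 4 l))
    ... | no  m-l≰N rewrite k>n⇒nCk≡0 (ℕP.≰⇒> m-l≰N) =
      trans (cong (+ blockPartitions 4 l *_) (ℤP.*-zeroˡ (δ (l ℕ.* 5) (N ∸ (m ∸ l))))) (ℤP.*-zeroʳ (+ blockPartitions 4 l))

    A-term-at : ∀ m N l → l ≤ m → N ≡ m ℕ.+ l ℕ.* 4 → A-term m N l ≡ + blockPartitions 4 l * + (N C (m ∸ l))
    A-term-at m _ l l≤m refl = cong (+ blockPartitions 4 l *_)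
      (trans (cong (+ ((m ℕ.+ l ℕ.* 4) C (m ∸ l)) *_) (trans (cong (δ (l ℕ.* 5)) N-[m-l]≡5l) (δ-diag (l ℕ.* 5))))
             (ℤP.*-identityʳ _))
      where
      regroup : ∀ x l → x ℕ.+ l ℕ.+ l ℕ.* 4 ≡ x ℕ.+ l ℕ.* 5
      regroup = ℕSolver.solve-∀
      N-[m-l]≡5l : m ℕ.+ l ℕ.* 4 ∸ (m ∸ l) ≡ l ℕ.* 5
      N-[m-l]≡5l = begin
          m ℕ.+ l ℕ.* 4 ∸ (m ∸ l)               ≡⟨ cong (λ k → k ℕ.+ l ℕ.* 4 ∸ (m ∸ l)) (ℕP.m∸n+n≡m l≤m) ⟨
          m ∸ l ℕ.+ l ℕ.+ l ℕ.* 4 ∸ (m ∸ l)     ≡⟨ cong (_∸ (m ∸ l)) (regroup (m ∸ l) l) ⟩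
          m ∸ l ℕ.+ l ℕ.* 5 ∸ (m ∸ l)           ≡⟨ ℕP.m+n∸m≡n (m ∸ l) (l ℕ.* 5) ⟩
          l ℕ.* 5                               ∎
        where open ≡-Reasoning

  A^[]-sum : ∀ m N → (A ^[ m ]) N ≡ ∑[ l ≤ m ] A-term m N l
  A^[]-sum m N = trans (^[]-⊕ (δ 1) (δ 5) m N) (∑-cong m λ l _ → term l)
    where
    term : ∀ l → (δ 1 ^[ m ∸ l ] ⋆ δ 5 ^[ l ]) N ≡ A-term m N l
    term l = begin
        (δ 1 ^[ m ∸ l ] ⋆ δ 5 ^[ l ]) N
      ≡⟨ ⋆-cong (δ₁-^[] (m ∸ l)) (δ-^[] 4 l) N ⟩
        (δ (m ∸ l) ⋆ (+ blockPartitions 4 l) · δ (l ℕ.* 5)) N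
      ≡⟨ ⋆-scaleʳ (+ blockPartitions 4 l) (δ (m ∸ l)) (δ (l ℕ.* 5)) N ⟩
        + blockPartitions 4 l * (δ (m ∸ l) ⋆ δ (l ℕ.* 5)) N
      ≡⟨ cong (+ blockPartitions 4 l *_) (δ-⋆ (m ∸ l) (δ (l ℕ.* 5)) N) ⟩
        A-term m N l
      ∎
      where open ≡-Reasoning

  A^[]-at : ∀ m N b → b ≤ m → N ≡ m ℕ.+ b ℕ.* 4 → (A ^[ m ]) N ≡ + blockPartitions 4 b * + (N C (m ∸ b))
  A^[]-at m N b b≤m N≡ = trans (A^[]-sum m N) (trans (∑-single m b b≤m off) (A-term-at m N b b≤m N≡))
    where
    off : ∀ l → l ≤ m → l ≢ b → A-term m N l ≡ + 0
    off l l≤m l≢b = A-term-off m N l l≤m λ N≡′ →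
      l≢b (ℕP.*-cancelʳ-≡ l b 4 (ℕP.+-cancelˡ-≡ m _ _ (trans (sym N≡′) N≡)))

  A^[]-off : ∀ m N → (∀ l → l ≤ m → N ≢ m ℕ.+ l ℕ.* 4) → (A ^[ m ]) N ≡ + 0
  A^[]-off m N N≢ = trans (A^[]-sum m N) (∑-zero m λ l l≤m → A-term-off m N l l≤m (N≢ l l≤m))

  C3-A^[]-off : ∀ m N → (∀ l → l ≤ m → N ≢ m ℕ.+ l ℕ.* 4 ℕ.+ 3) → + (N C 3) * (A ^[ m ]) (N ∸ 3) ≡ + 0
  C3-A^[]-off m N N≢ with 3 ℕ.≤? N
  ... | yes 3≤N = trans (cong (+ (N C 3) *_) (A^[]-off m (N ∸ 3) N-3≢)) (ℤP.*-zeroʳ (+ (N C 3)))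
    where
    N-3≢ : ∀ l → l ≤ m → N ∸ 3 ≢ m ℕ.+ l ℕ.* 4
    N-3≢ l l≤m N-3≡ = N≢ l l≤m (trans (sym (ℕP.m∸n+n≡m 3≤N)) (cong (ℕ._+ 3) N-3≡))
  ... | no  3≰N rewrite k>n⇒nCk≡0 (ℕP.≰⇒> 3≰N) = ℤP.*-zeroˡ ((A ^[ m ]) (N ∸ 3))

  parity-mismatch : ∀ k x y → 2 ℕ.* (k ℕ.+ 2 ℕ.* x) ≢ 2 ℕ.* (k ℕ.+ suc (2 ℕ.* y))
  parity-mismatch k x y eq = ℕP.even≢odd x y (ℕP.+-cancelˡ-≡ k _ _ (ℕP.*-cancelˡ-≡ _ _ 2 eq))

  2[1+k]∸1≡1+2k : ∀ k → 2 ℕ.* suc k ∸ 1 ≡ suc (2 ℕ.* k)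
  2[1+k]∸1≡1+2k k = cong (_∸ 1) (expand k)
    where
    expand : ∀ k → 2 ℕ.* suc k ≡ 1 ℕ.+ suc (2 ℕ.* k)
    expand = ℕSolver.solve-∀

  2[1+k]∸1+l*4+3≡2[2+k+2l] : ∀ k l → 2 ℕ.* suc k ∸ 1 ℕ.+ l ℕ.* 4 ℕ.+ 3 ≡ 2 ℕ.* (suc k ℕ.+ suc (2 ℕ.* l))
  2[1+k]∸1+l*4+3≡2[2+k+2l] k l rewrite 2[1+k]∸1≡1+2k k = regroup k l
    where
    regroup : ∀ k l → suc (2 ℕ.* k) ℕ.+ l ℕ.* 4 ℕ.+ 3 ≡ 2 ℕ.* (suc k ℕ.+ suc (2 ℕ.* l))
    regroup = ℕSolver.solve-∀

  2[1+k+2l]≡2[1+k]+l*4 : ∀ k l → 2 ℕ.* (suc k ℕ.+ 2 ℕ.* l) ≡ 2 ℕ.* suc k ℕ.+ l ℕ.* 4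
  2[1+k+2l]≡2[1+k]+l*4 = ℕSolver.solve-∀

  G^[]-even : ∀ k b → b ≤ 2 ℕ.* suc k →
    (G ^[ 2 ℕ.* suc k ]) (2 ℕ.* (suc k ℕ.+ 2 ℕ.* b))
      ≡ + blockPartitions 4 b * + ((2 ℕ.* (suc k ℕ.+ 2 ℕ.* b)) C (2 ℕ.* suc k ∸ b)) [mod + 5 ]
  G^[]-even k b b≤2k = ≡-mod-trans (G^[1+m]≡A^[1+m]+δ₃⋆A^[m] (2 ℕ.* suc k ∸ 1) N)
                                   (≡⇒≡-mod (trans (cong₂ _+_ main extra) (ℤP.+-identityʳ _)))
    where
    N = 2 ℕ.* (suc k ℕ.+ 2 ℕ.* b)
    main : (A ^[ 2 ℕ.* suc k ]) N ≡ + blockPartitions 4 b * + (N C (2 ℕ.* suc k ∸ b))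
    main = A^[]-at (2 ℕ.* suc k) N b b≤2k (2[1+k+2l]≡2[1+k]+l*4 k b)
    extra : + (N C 3) * (A ^[ 2 ℕ.* suc k ∸ 1 ]) (N ∸ 3) ≡ + 0
    extra = C3-A^[]-off (2 ℕ.* suc k ∸ 1) N λ l _ N≡ → parity-mismatch (suc k) b l (trans N≡ (2[1+k]∸1+l*4+3≡2[2+k+2l] k l))

  G^[]-odd : ∀ k b → b ≤ 2 ℕ.* suc k ∸ 1 →
    (G ^[ 2 ℕ.* suc k ]) (2 ℕ.* (suc k ℕ.+ suc (2 ℕ.* b)))
      ≡ + ((2 ℕ.* (suc k ℕ.+ suc (2 ℕ.* b))) C 3)
        * (+ blockPartitions 4 b * + ((2 ℕ.* (suc k ℕ.+ suc (2 ℕ.* b)) ∸ 3) C (2 ℕ.* suc k ∸ 1 ∸ b))) [mod + 5 ]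
  G^[]-odd k b b≤2k-1 = ≡-mod-trans (G^[1+m]≡A^[1+m]+δ₃⋆A^[m] (2 ℕ.* suc k ∸ 1) N)
    (≡⇒≡-mod (trans (cong (_+ + (N C 3) * (A ^[ 2 ℕ.* suc k ∸ 1 ]) (N ∸ 3)) main)
                    (trans (ℤP.+-identityˡ _) (cong (+ (N C 3) *_) extra))))
    where
    N = 2 ℕ.* (suc k ℕ.+ suc (2 ℕ.* b))
    main : (A ^[ 2 ℕ.* suc k ]) N ≡ + 0
    main = A^[]-off (2 ℕ.* suc k) N λ l _ N≡ → parity-mismatch (suc k) l b (trans (2[1+k+2l]≡2[1+k]+l*4 k l) (sym N≡))
    extra : (A ^[ 2 ℕ.* suc k ∸ 1 ]) (N ∸ 3) ≡ + blockPartitions 4 b * + ((N ∸ 3) C (2 ℕ.* suc k ∸ 1 ∸ b))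
    extra = A^[]-at (2 ℕ.* suc k ∸ 1) (N ∸ 3) b b≤2k-1
      (trans (cong (_∸ 3) (sym (2[1+k]∸1+l*4+3≡2[2+k+2l] k b))) (ℕP.m+n∸n≡m _ 3))

  G^[]-large : ∀ k n → 5 ℕ.* suc k < n → (G ^[ 2 ℕ.* suc k ]) (2 ℕ.* n) ≡ + 0 [mod + 5 ]
  G^[]-large k n 5k<n = ≡-mod-trans (G^[1+m]≡A^[1+m]+δ₃⋆A^[m] (2 ℕ.* suc k ∸ 1) (2 ℕ.* n))
                                    (≡⇒≡-mod (cong₂ _+_ main extra))
    where
    beyond : ∀ {x} → x ≤ 2 ℕ.* (5 ℕ.* suc k) → 2 ℕ.* n ≢ x
    beyond x≤ 2n≡x = ℕP.<⇒≢ (ℕP.≤-<-trans x≤ (ℕP.*-monoʳ-< 2 5k<n)) (sym 2n≡x)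
    main : (A ^[ 2 ℕ.* suc k ]) (2 ℕ.* n) ≡ + 0
    main = A^[]-off (2 ℕ.* suc k) (2 ℕ.* n) λ l l≤2k → beyond (begin
        2 ℕ.* suc k ℕ.+ l ℕ.* 4               ≤⟨ ℕP.+-monoʳ-≤ (2 ℕ.* suc k) (ℕP.*-monoˡ-≤ 4 l≤2k) ⟩
        2 ℕ.* suc k ℕ.+ 2 ℕ.* suc k ℕ.* 4     ≡⟨ regroup k ⟩
        2 ℕ.* (5 ℕ.* suc k)                   ∎)
      where
      open ℕP.≤-Reasoning
      regroup : ∀ k → 2 ℕ.* suc k ℕ.+ 2 ℕ.* suc k ℕ.* 4 ≡ 2 ℕ.* (5 ℕ.* suc k)
      regroup = ℕSolver.solve-∀
    extra : + ((2 ℕ.* n) C 3) * (A ^[ 2 ℕ.* suc k ∸ 1 ]) (2 ℕ.* n ∸ 3) ≡ + 0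
    extra = C3-A^[]-off (2 ℕ.* suc k ∸ 1) (2 ℕ.* n) λ l l≤2k-1 → beyond (begin
        2 ℕ.* suc k ∸ 1 ℕ.+ l ℕ.* 4 ℕ.+ 3       ≡⟨ 2[1+k]∸1+l*4+3≡2[2+k+2l] k l ⟩
        2 ℕ.* (suc k ℕ.+ suc (2 ℕ.* l))         ≤⟨ ℕP.*-monoʳ-≤ 2 (ℕP.+-monoʳ-≤ (suc k) (s≤s (ℕP.*-monoʳ-≤ 2
                                                     (subst (l ≤_) (2[1+k]∸1≡1+2k k) l≤2k-1)))) ⟩
        2 ℕ.* (suc k ℕ.+ suc (2 ℕ.* suc (2 ℕ.* k))) ≤⟨ ℕP.m≤m+n _ 2 ⟩
        2 ℕ.* (suc k ℕ.+ suc (2 ℕ.* suc (2 ℕ.* k))) ℕ.+ 2 ≡⟨ regroup k ⟩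
        2 ℕ.* (5 ℕ.* suc k)                     ∎)
      where
      open ℕP.≤-Reasoning
      regroup : ∀ k → 2 ℕ.* (suc k ℕ.+ suc (2 ℕ.* suc (2 ℕ.* k))) ℕ.+ 2 ≡ 2 ℕ.* (5 ℕ.* suc k)
      regroup = ℕSolver.solve-∀

module Fractions where

  open import Data.Nat using (NonZero; ≢-nonZero⁻¹)
  open import Data.Integer using (_+_; _*_; _-_; -_)
  open import Data.Rational as ℚ using (_/_; toℚᵘ)
  import Data.Rational.Properties as ℚP
  import Data.Rational.Unnormalised as ℚᵘ
  import Data.Rational.Unnormalised.Properties as ℚᵘP

  private
    toℚᵘ-/ : ∀ i d .{{_ : NonZero d}} → toℚᵘ (i / d) ℚᵘ.≃ (i ℚᵘ./ d)
    toℚᵘ-/ i zero    {{0≢0}} = ⊥-elim (≢-nonZero⁻¹ zero {{0≢0}} refl)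
    toℚᵘ-/ i (suc d)         = ℚP.toℚᵘ-fromℚᵘ (ℚᵘ.mkℚᵘ i d)

  *≡*⇒/≡/ : ∀ i j d e .{{_ : NonZero d}} .{{_ : NonZero e}} → i * + e ≡ j * + d → i / d ≡ j / e
  *≡*⇒/≡/ i j zero    e       {{0≢0}}        _  = ⊥-elim (≢-nonZero⁻¹ zero {{0≢0}} refl)
  *≡*⇒/≡/ i j (suc d) zero    {{_}} {{0≢0}}  _  = ⊥-elim (≢-nonZero⁻¹ zero {{0≢0}} refl)
  *≡*⇒/≡/ i j (suc d) (suc e)                eq =
    ℚP.toℚᵘ-injective (ℚᵘP.≃-trans (toℚᵘ-/ i (suc d))
                      (ℚᵘP.≃-trans (ℚᵘ.*≡* eq) (ℚᵘP.≃-sym (toℚᵘ-/ j (suc e)))))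

  /-+-/ : ∀ i j d e .{{_ : NonZero d}} .{{_ : NonZero e}} →
          i / d ℚ.+ j / e ≡ _/_ (i * + e + j * + d) (d ℕ.* e) {{ℕP.m*n≢0 d e}}
  /-+-/ i j zero    e       {{0≢0}}        = ⊥-elim (≢-nonZero⁻¹ zero {{0≢0}} refl)
  /-+-/ i j (suc d) zero    {{_}} {{0≢0}}  = ⊥-elim (≢-nonZero⁻¹ zero {{0≢0}} refl)
  /-+-/ i j (suc d) (suc e)                = ℚP.toℚᵘ-injective (ℚᵘP.≃-trans (ℚP.toℚᵘ-homo-+ (i / suc d) (j / suc e))
    (ℚᵘP.≃-trans (ℚᵘP.+-cong (toℚᵘ-/ i (suc d)) (toℚᵘ-/ j (suc e))) (ℚᵘP.≃-sym (toℚᵘ-/ _ (suc d ℕ.* suc e)))))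

  /-*-/ : ∀ i j d e .{{_ : NonZero d}} .{{_ : NonZero e}} →
          (i / d) ℚ.* (j / e) ≡ _/_ (i * j) (d ℕ.* e) {{ℕP.m*n≢0 d e}}
  /-*-/ i j zero    e       {{0≢0}}        = ⊥-elim (≢-nonZero⁻¹ zero {{0≢0}} refl)
  /-*-/ i j (suc d) zero    {{_}} {{0≢0}}  = ⊥-elim (≢-nonZero⁻¹ zero {{0≢0}} refl)
  /-*-/ i j (suc d) (suc e)                = ℚP.toℚᵘ-injective (ℚᵘP.≃-trans (ℚP.toℚᵘ-homo-* (i / suc d) (j / suc e))
    (ℚᵘP.≃-trans (ℚᵘP.*-cong (toℚᵘ-/ i (suc d)) (toℚᵘ-/ j (suc e))) (ℚᵘP.≃-sym (toℚᵘ-/ _ (suc d ℕ.* suc e)))))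

  -‿/ : ∀ i d .{{_ : NonZero d}} → ℚ.- (i / d) ≡ (- i) / d
  -‿/ i zero    {{0≢0}} = ⊥-elim (≢-nonZero⁻¹ zero {{0≢0}} refl)
  -‿/ i (suc d)         = ℚP.toℚᵘ-injective (ℚᵘP.≃-trans (ℚP.toℚᵘ-homo‿- (i / suc d))
    (ℚᵘP.≃-trans (ℚᵘP.-‿cong (toℚᵘ-/ i (suc d))) (ℚᵘP.≃-sym (toℚᵘ-/ (- i) (suc d)))))

  /-distribʳ-+ : ∀ i j d .{{_ : NonZero d}} → (i + j) / d ≡ i / d ℚ.+ j / d
  /-distribʳ-+ i j d = sym (trans (/-+-/ i j d d) (*≡*⇒/≡/ (i * + d + j * + d) (i + j) (d ℕ.* d) d {{ℕP.m*n≢0 d d}} cross))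
    where
    regroup : ∀ i j d → (i * d + j * d) * d ≡ (i + j) * (d * d)
    regroup = solve-∀
    cross : (i * + d + j * + d) * + d ≡ (i + j) * + (d ℕ.* d)
    cross = trans (regroup i j (+ d)) (cong ((i + j) *_) (sym (ℤP.pos-* d d)))

  /1-homo-sub : ∀ i j → i / 1 ℚ.- j / 1 ≡ (i - j) / 1
  /1-homo-sub i j = begin
      i / 1 ℚ.- j / 1       ≡⟨ cong (i / 1 ℚ.+_) (-‿/ j 1) ⟩
      i / 1 ℚ.+ (- j) / 1   ≡⟨ /-distribʳ-+ i (- j) 1 ⟨
      (i - j) / 1           ∎
    where open ≡-Reasoning

module Factorials where

  open import Data.Nat.Properties using (_!≢0)
  import Data.Nat.DivMod as ℕD
  open import Data.Nat.Combinatorics using (nCk≡n!/k![n-k]!; k![n∸k]!∣n!)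
  import Data.Nat.Tactic.RingSolver as ℕSolver
  open ExponentialSeries using (blockPartitions)

  nCk*k!*[n∸k]!≡n! : ∀ {n k} → k ≤ n → (n C k) ℕ.* (k ! ℕ.* (n ∸ k) !) ≡ n !
  nCk*k!*[n∸k]!≡n! {n} {k} k≤n =
    trans (cong (ℕ._* (k ! ℕ.* (n ∸ k) !)) (nCk≡n!/k![n-k]! k≤n)) (ℕD.m/n*n≡m (k![n∸k]!∣n! k≤n))
    where instance _ = ℕP.m*n≢0 (k !) ((n ∸ k) !) {{k !≢0}} {{(n ∸ k) !≢0}}

  blockPartitions-factorial : ∀ d l → blockPartitions d l ℕ.* (l ! ℕ.* (suc d !) ℕ.^ l) ≡ (l ℕ.* suc d) !
  blockPartitions-factorial d zero    = refl
  blockPartitions-factorial d (suc l) = begin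
      blockPartitions d l ℕ.* c ℕ.* (suc l ℕ.* l ! ℕ.* (suc d ℕ.* d ! ℕ.* (suc d !) ℕ.^ l))
    ≡⟨ regroup (blockPartitions d l) c l (l !) d (d !) ((suc d !) ℕ.^ l) ⟩
      suc l ℕ.* suc d ℕ.* (c ℕ.* (d ! ℕ.* (blockPartitions d l ℕ.* (l ! ℕ.* (suc d !) ℕ.^ l))))
    ≡⟨ cong (λ t → suc l ℕ.* suc d ℕ.* (c ℕ.* (d ! ℕ.* t))) (blockPartitions-factorial d l) ⟩
      suc l ℕ.* suc d ℕ.* (c ℕ.* (d ! ℕ.* (l ℕ.* suc d) !))
    ≡⟨ cong (λ t → suc l ℕ.* suc d ℕ.* (c ℕ.* (d ! ℕ.* t !))) (ℕP.m+n∸m≡n d (l ℕ.* suc d)) ⟨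
      suc l ℕ.* suc d ℕ.* (c ℕ.* (d ! ℕ.* (d ℕ.+ l ℕ.* suc d ∸ d) !))
    ≡⟨ cong (suc l ℕ.* suc d ℕ.*_) (nCk*k!*[n∸k]!≡n! (ℕP.m≤m+n d (l ℕ.* suc d))) ⟩
      suc l ℕ.* suc d ℕ.* (d ℕ.+ l ℕ.* suc d) !
    ∎
    where
    open ≡-Reasoning
    c = (d ℕ.+ l ℕ.* suc d) C d
    regroup : ∀ p c l L d D E → p ℕ.* c ℕ.* (suc l ℕ.* L ℕ.* (suc d ℕ.* D ℕ.* E))
                              ≡ suc l ℕ.* suc d ℕ.* (c ℕ.* (D ℕ.* (p ℕ.* (L ℕ.* E))))
    regroup = ℕSolver.solve-∀

module Coefficients where

  open import Data.Nat using (NonZero)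
  open import Data.Nat.Properties using (_!≢0)
  open import Data.Integer using (_+_; _*_)
  open import Data.Rational as ℚ using (ℚ; _/_)
  import Data.Rational.Properties as ℚP
  open import Defs using (F; _^ₛ_; sumUpTo; s; r)
  open ExponentialSeries
  open Recurrence using (F-coeff)
  open Fractions
  open Factorials using (nCk*k!*[n∸k]!≡n!)

  sumUpTo-cong : ∀ N {f g : ℕ → ℚ} → (∀ i → i ≤ N → f i ≡ g i) → sumUpTo N f ≡ sumUpTo N g
  sumUpTo-cong zero    f≡g = f≡g 0 z≤n
  sumUpTo-cong (suc N) f≡g =
    cong₂ ℚ._+_ (sumUpTo-cong N λ i i≤N → f≡g i (ℕP.m≤n⇒m≤1+n i≤N)) (f≡g (suc N) ℕP.≤-refl)

  sumUpTo-/ : ∀ N h d .{{_ : NonZero d}} → sumUpTo N (λ i → h i / d) ≡ ∑≤ N h / d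
  sumUpTo-/ zero    h d = refl
  sumUpTo-/ (suc N) h d = trans (cong (ℚ._+ h (suc N) / d) (sumUpTo-/ N h d)) (sym (/-distribʳ-+ (∑≤ N h) (h (suc N)) d))

  F≡F-coeff/! : ∀ N → F N ≡ _/_ (F-coeff N) (N !) {{N !≢0}}
  F≡F-coeff/! N with N ℕ.% 2 ℕ.≟ 1
  ... | yes _ = refl
  ... | no  _ = sym (ℚP.0/n≡0 (N !) {{N !≢0}})

  F^ₛ≡F-coeff^⋆/! : ∀ m N → (F ^ₛ m) N ≡ _/_ ((F-coeff ^⋆ m) N) (N !) {{N !≢0}}
  F^ₛ≡F-coeff^⋆/! zero    zero    = refl
  F^ₛ≡F-coeff^⋆/! zero    (suc N) = sym (ℚP.0/n≡0 (suc N !) {{suc N !≢0}})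
  F^ₛ≡F-coeff^⋆/! (suc m) N = begin
      sumUpTo N (λ i → (F ^ₛ m) i ℚ.* F (N ∸ i))
    ≡⟨ sumUpTo-cong N term ⟩
      sumUpTo N (λ i → _/_ (binomialTerm i) (N !) {{N !≢0}})
    ≡⟨ sumUpTo-/ N binomialTerm (N !) {{N !≢0}} ⟩
      _/_ (binomialSum (F-coeff ^⋆ m) F-coeff N) (N !) {{N !≢0}}
    ≡⟨ cong (λ z → _/_ z (N !) {{N !≢0}}) (⋆-binomial (F-coeff ^⋆ m) F-coeff N) ⟨
      _/_ ((F-coeff ^⋆ m ⋆ F-coeff) N) (N !) {{N !≢0}}
    ∎
    where
    open ≡-Reasoning
    binomialTerm : ℕ → ℤ
    binomialTerm i = + (N C i) * (F-coeff ^⋆ m) i * F-coeff (N ∸ i)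
    term : ∀ i → i ≤ N → (F ^ₛ m) i ℚ.* F (N ∸ i) ≡ _/_ (binomialTerm i) (N !) {{N !≢0}}
    term i i≤N = begin
        (F ^ₛ m) i ℚ.* F (N ∸ i)
      ≡⟨ cong₂ ℚ._*_ (F^ₛ≡F-coeff^⋆/! m i) (F≡F-coeff/! (N ∸ i)) ⟩
        _/_ ((F-coeff ^⋆ m) i) (i !) {{i !≢0}} ℚ.* _/_ (F-coeff (N ∸ i)) ((N ∸ i) !) {{(N ∸ i) !≢0}}
      ≡⟨ /-*-/ ((F-coeff ^⋆ m) i) (F-coeff (N ∸ i)) (i !) ((N ∸ i) !) {{i !≢0}} {{(N ∸ i) !≢0}} ⟩
        _/_ ((F-coeff ^⋆ m) i * F-coeff (N ∸ i)) (i ! ℕ.* (N ∸ i) !) {{i![N∸i]!≢0}}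
      ≡⟨ *≡*⇒/≡/ ((F-coeff ^⋆ m) i * F-coeff (N ∸ i)) (binomialTerm i) (i ! ℕ.* (N ∸ i) !) (N !)
                 {{i![N∸i]!≢0}} {{N !≢0}} cross ⟩
        _/_ (binomialTerm i) (N !) {{N !≢0}}
      ∎
      where
      i![N∸i]!≢0 = ℕP.m*n≢0 (i !) ((N ∸ i) !) {{i !≢0}} {{(N ∸ i) !≢0}}
      regroup : ∀ a b c d → a * b * (c * d) ≡ c * a * b * d
      regroup = solve-∀
      cross : (F-coeff ^⋆ m) i * F-coeff (N ∸ i) * + (N !) ≡ binomialTerm i * + (i ! ℕ.* (N ∸ i) !)
      cross = begin
          (F-coeff ^⋆ m) i * F-coeff (N ∸ i) * + (N !)
        ≡⟨ cong (λ z → (F-coeff ^⋆ m) i * F-coeff (N ∸ i) * + z) (nCk*k!*[n∸k]!≡n! i≤N) ⟨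
          (F-coeff ^⋆ m) i * F-coeff (N ∸ i) * + ((N C i) ℕ.* (i ! ℕ.* (N ∸ i) !))
        ≡⟨ cong ((F-coeff ^⋆ m) i * F-coeff (N ∸ i) *_) (ℤP.pos-* (N C i) _) ⟩
          (F-coeff ^⋆ m) i * F-coeff (N ∸ i) * (+ (N C i) * + (i ! ℕ.* (N ∸ i) !))
        ≡⟨ regroup ((F-coeff ^⋆ m) i) (F-coeff (N ∸ i)) (+ (N C i)) _ ⟩
          binomialTerm i * + (i ! ℕ.* (N ∸ i) !)
        ∎

  s≡F-coeff^[] : ∀ n k → s n k ≡ (F-coeff ^[ 2 ℕ.* k ]) (2 ℕ.* n) / 1
  s≡F-coeff^[] n k = begin
      ratio ℚ.* (F ^ₛ (2 ℕ.* k)) (2 ℕ.* n)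
    ≡⟨ cong (ratio ℚ.*_) (F^ₛ≡F-coeff^⋆/! (2 ℕ.* k) (2 ℕ.* n)) ⟩
      ratio ℚ.* _/_ power ((2 ℕ.* n) !) {{(2 ℕ.* n) !≢0}}
    ≡⟨ /-*-/ (+ ((2 ℕ.* n) !)) power ((2 ℕ.* k) !) ((2 ℕ.* n) !) {{(2 ℕ.* k) !≢0}} {{(2 ℕ.* n) !≢0}} ⟩
      _/_ (+ ((2 ℕ.* n) !) * power) ((2 ℕ.* k) ! ℕ.* (2 ℕ.* n) !) {{denominator≢0}}
    ≡⟨ *≡*⇒/≡/ (+ ((2 ℕ.* n) !) * power) ((F-coeff ^[ 2 ℕ.* k ]) (2 ℕ.* n)) ((2 ℕ.* k) ! ℕ.* (2 ℕ.* n) !) 1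
               {{denominator≢0}} cross ⟩
      (F-coeff ^[ 2 ℕ.* k ]) (2 ℕ.* n) / 1
    ∎
    where
    open ≡-Reasoning
    ratio = _/_ (+ ((2 ℕ.* n) !)) ((2 ℕ.* k) !) {{(2 ℕ.* k) !≢0}}
    power = (F-coeff ^⋆ (2 ℕ.* k)) (2 ℕ.* n)
    denominator≢0 = ℕP.m*n≢0 ((2 ℕ.* k) !) ((2 ℕ.* n) !) {{(2 ℕ.* k) !≢0}} {{(2 ℕ.* n) !≢0}}
    regroup : ∀ a b c → a * (b * c) * + 1 ≡ c * (b * a)
    regroup = solve-∀
    cross : + ((2 ℕ.* n) !) * power * + 1 ≡ (F-coeff ^[ 2 ℕ.* k ]) (2 ℕ.* n) * + ((2 ℕ.* k) ! ℕ.* (2 ℕ.* n) !)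
    cross = begin
        + ((2 ℕ.* n) !) * power * + 1
      ≡⟨ cong (λ z → + ((2 ℕ.* n) !) * z * + 1) (^⋆≗!·^[] F-coeff refl (2 ℕ.* k) (2 ℕ.* n)) ⟩
        + ((2 ℕ.* n) !) * (+ ((2 ℕ.* k) !) * (F-coeff ^[ 2 ℕ.* k ]) (2 ℕ.* n)) * + 1
      ≡⟨ regroup (+ ((2 ℕ.* n) !)) (+ ((2 ℕ.* k) !)) _ ⟩
        (F-coeff ^[ 2 ℕ.* k ]) (2 ℕ.* n) * (+ ((2 ℕ.* k) !) * + ((2 ℕ.* n) !))
      ≡⟨ cong ((F-coeff ^[ 2 ℕ.* k ]) (2 ℕ.* n) *_) (ℤP.pos-* ((2 ℕ.* k) !) ((2 ℕ.* n) !)) ⟨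
        (F-coeff ^[ 2 ℕ.* k ]) (2 ℕ.* n) * + ((2 ℕ.* k) ! ℕ.* (2 ℕ.* n) !)
      ∎

  r≡2^[n∸k]*F-coeff^[] : ∀ n k → r n k ≡ (+ (2 ℕ.^ (n ∸ k)) * (F-coeff ^[ 2 ℕ.* k ]) (2 ℕ.* n)) / 1
  r≡2^[n∸k]*F-coeff^[] n k =
    trans (cong ((+ (2 ℕ.^ (n ∸ k)) / 1) ℚ.*_) (s≡F-coeff^[] n k)) (/-*-/ (+ (2 ℕ.^ (n ∸ k))) _ 1 1)

module CongruencesOfR where

  open import Data.Nat.Properties using (_!≢0; m*n≢0; m^n≢0)
  import Data.Nat.DivMod as ℕD
  open import Data.Integer using (_+_; _*_)
  open import Data.Integer.Divisibility.Signed using (divides)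
  open import Data.Rational using (_/_; 0ℚ)
  import Data.Nat.Tactic.RingSolver as ℕSolver
  open import Data.Product using (_×_; _,_)
  open import Defs using (r; fracFact; IsInt; _≡₅_)
  open ExponentialSeries
  open Congruence
  open Recurrence using (F-coeff; G; F-coeff≡G)
  open ReducedSeries
  open Fractions
  open Factorials
  open Coefficients

  ≡-mod⇒≡₅ : ∀ {x y} → x ≡ y [mod + 5 ] → (x / 1) ≡₅ (y / 1)
  ≡-mod⇒≡₅ {x} {y} (congruent (divides q x-y≡q*5)) =
    q , trans (/1-homo-sub x y) (cong (_/ 1) (trans x-y≡q*5 (ℤP.*-comm q (+ 5))))

  6^e≡1 : ∀ e → + (6 ℕ.^ e) ≡ + 1 [mod + 5 ]
  6^e≡1 zero    = ≡⇒≡-mod refl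
  6^e≡1 (suc e) = subst (λ z → z ≡ + 1 [mod + 5 ]) (sym (ℤP.pos-* 6 (6 ℕ.^ e)))
                        (*-cong-mod 6≡1 (6^e≡1 e))
    where
    6≡1 : + 6 ≡ + 1 [mod + 5 ]
    6≡1 = congruent (divides (+ 1) refl)

  r≡₅2^[n∸k]*Y*6^e : ∀ n k Y e → (F-coeff ^[ 2 ℕ.* k ]) (2 ℕ.* n) ≡ + Y [mod + 5 ] →
        r n k ≡₅ (+ (2 ℕ.^ (n ∸ k) ℕ.* Y ℕ.* 6 ℕ.^ e) / 1)
  r≡₅2^[n∸k]*Y*6^e n k Y e F≡Y = subst (_≡₅ (+ (2 ℕ.^ (n ∸ k) ℕ.* Y ℕ.* 6 ℕ.^ e) / 1)) (sym (r≡2^[n∸k]*F-coeff^[] n k))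
    (≡-mod⇒≡₅ (≡-mod-trans (*-cong-mod (≡⇒≡-mod {+ (2 ℕ.^ (n ∸ k))} refl) (≡-mod-trans F≡Y Y≡Y*6^e))
                           (≡⇒≡-mod product)))
    where
    Y≡Y*6^e : + Y ≡ + Y * + (6 ℕ.^ e) [mod + 5 ]
    Y≡Y*6^e = ≡-mod-trans (≡⇒≡-mod (sym (ℤP.*-identityʳ (+ Y))))
                          (*-cong-mod (≡⇒≡-mod {+ Y} refl) (≡-mod-sym (6^e≡1 e)))
    product : + (2 ℕ.^ (n ∸ k)) * (+ Y * + (6 ℕ.^ e)) ≡ + (2 ℕ.^ (n ∸ k) ℕ.* Y ℕ.* 6 ℕ.^ e)
    product = sym (trans (ℤP.pos-* (2 ℕ.^ (n ∸ k) ℕ.* Y) (6 ℕ.^ e))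
                  (trans (cong (_* + (6 ℕ.^ e)) (ℤP.pos-* (2 ℕ.^ (n ∸ k)) Y)) (ℤP.*-assoc (+ (2 ℕ.^ (n ∸ k))) (+ Y) (+ (6 ℕ.^ e)))))

  fracFact≡ : ∀ c N a b d T → c ℕ.* N ! ≡ T ℕ.* (a ! ℕ.* b ! ℕ.* 5 ℕ.^ d) → fracFact c N a b d ≡ + T / 1
  fracFact≡ c N a b d T eq = *≡*⇒/≡/ (+ (c ℕ.* N !)) (+ T) (a ! ℕ.* b ! ℕ.* 5 ℕ.^ d) 1
    {{m*n≢0 _ _ {{m*n≢0 _ _ {{a !≢0}} {{b !≢0}}}} {{m^n≢0 5 d}}}}
    (trans (sym (ℤP.pos-* (c ℕ.* N !) 1)) (trans (cong +_ (trans (ℕP.*-identityʳ _) eq)) (ℤP.pos-* T _)))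

  private
    4^b*6^b*5^b≡120^b : ∀ b → 4 ℕ.^ b ℕ.* 6 ℕ.^ b ℕ.* 5 ℕ.^ b ≡ 120 ℕ.^ b
    4^b*6^b*5^b≡120^b zero    = refl
    4^b*6^b*5^b≡120^b (suc b) = trans (regroup (4 ℕ.^ b) (6 ℕ.^ b) (5 ℕ.^ b)) (cong (120 ℕ.*_) (4^b*6^b*5^b≡120^b b))
      where
      regroup : ∀ x y z → 4 ℕ.* x ℕ.* (6 ℕ.* y) ℕ.* (5 ℕ.* z) ≡ 120 ℕ.* (x ℕ.* y ℕ.* z)
      regroup = ℕSolver.solve-∀

    F-coeff^[]≡G^[] : ∀ m N → (F-coeff ^[ m ]) N ≡ (G ^[ m ]) N [mod + 5 ]
    F-coeff^[]≡G^[] = ^[]-cong-mod F-coeff≡G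

  even-case : ∀ k b n a c → n ≡ suc k ℕ.+ 2 ℕ.* b → a ≡ 2 ℕ.* suc k ∸ b → c ≡ b → b ≤ 2 ℕ.* suc k →
    IsInt (fracFact 1 (2 ℕ.* n) a c c) × (r n (suc k) ≡₅ fracFact 1 (2 ℕ.* n) a c c)
  even-case k b _ _ _ refl refl refl b≤2k =
    (+ T , frac≡) , subst (r n (suc k) ≡₅_) (sym frac≡) (r≡₅2^[n∸k]*Y*6^e n (suc k) Y b F^[]≡Y)
    where
    n = suc k ℕ.+ 2 ℕ.* b
    N = 2 ℕ.* n
    a = 2 ℕ.* suc k ∸ b
    Y = blockPartitions 4 b ℕ.* (N C a)
    T = 2 ℕ.^ (n ∸ suc k) ℕ.* Y ℕ.* 6 ℕ.^ b
    F^[]≡Y : (F-coeff ^[ 2 ℕ.* suc k ]) N ≡ + Y [mod + 5 ]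
    F^[]≡Y = ≡-mod-trans (F-coeff^[]≡G^[] (2 ℕ.* suc k) N)
               (≡-mod-trans (G^[]-even k b b≤2k) (≡⇒≡-mod (sym (ℤP.pos-* (blockPartitions 4 b) (N C a)))))
    N≡a+5b : N ≡ a ℕ.+ b ℕ.* 5
    N≡a+5b = trans (expand k b) (trans (cong (λ t → t ℕ.+ b ℕ.* 4) (sym (ℕP.m∸n+n≡m b≤2k))) (regroup a b))
      where
      expand : ∀ k b → 2 ℕ.* (suc k ℕ.+ 2 ℕ.* b) ≡ 2 ℕ.* suc k ℕ.+ b ℕ.* 4
      expand = ℕSolver.solve-∀
      regroup : ∀ a b → a ℕ.+ b ℕ.+ b ℕ.* 4 ≡ a ℕ.+ b ℕ.* 5
      regroup = ℕSolver.solve-∀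
    identity : T ℕ.* (a ! ℕ.* b ! ℕ.* 5 ℕ.^ b) ≡ 1 ℕ.* N !
    identity = begin
        2 ℕ.^ (n ∸ suc k) ℕ.* Y ℕ.* 6 ℕ.^ b ℕ.* (a ! ℕ.* b ! ℕ.* 5 ℕ.^ b)
      ≡⟨ cong (λ t → 2 ℕ.^ t ℕ.* Y ℕ.* 6 ℕ.^ b ℕ.* (a ! ℕ.* b ! ℕ.* 5 ℕ.^ b)) (ℕP.m+n∸m≡n (suc k) (2 ℕ.* b)) ⟩
        2 ℕ.^ (2 ℕ.* b) ℕ.* Y ℕ.* 6 ℕ.^ b ℕ.* (a ! ℕ.* b ! ℕ.* 5 ℕ.^ b)
      ≡⟨ cong (λ t → t ℕ.* Y ℕ.* 6 ℕ.^ b ℕ.* (a ! ℕ.* b ! ℕ.* 5 ℕ.^ b)) (ℕP.^-*-assoc 2 2 b) ⟨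
        4 ℕ.^ b ℕ.* (blockPartitions 4 b ℕ.* (N C a)) ℕ.* 6 ℕ.^ b ℕ.* (a ! ℕ.* b ! ℕ.* 5 ℕ.^ b)
      ≡⟨ regroup (4 ℕ.^ b) (blockPartitions 4 b) (N C a) (6 ℕ.^ b) (a !) (b !) (5 ℕ.^ b) ⟩
        (N C a) ℕ.* (a ! ℕ.* (blockPartitions 4 b ℕ.* (b ! ℕ.* (4 ℕ.^ b ℕ.* 6 ℕ.^ b ℕ.* 5 ℕ.^ b))))
      ≡⟨ cong (λ t → (N C a) ℕ.* (a ! ℕ.* (blockPartitions 4 b ℕ.* (b ! ℕ.* t)))) (4^b*6^b*5^b≡120^b b) ⟩
        (N C a) ℕ.* (a ! ℕ.* (blockPartitions 4 b ℕ.* (b ! ℕ.* 120 ℕ.^ b)))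
      ≡⟨ cong (λ t → (N C a) ℕ.* (a ! ℕ.* t)) (blockPartitions-factorial 4 b) ⟩
        (N C a) ℕ.* (a ! ℕ.* (b ℕ.* 5) !)
      ≡⟨ cong (λ t → (N C a) ℕ.* (a ! ℕ.* t !)) (trans (sym (ℕP.m+n∸m≡n a (b ℕ.* 5))) (cong (_∸ a) (sym N≡a+5b))) ⟩
        (N C a) ℕ.* (a ! ℕ.* (N ∸ a) !)
      ≡⟨ nCk*k!*[n∸k]!≡n! (subst (a ≤_) (sym N≡a+5b) (ℕP.m≤m+n a (b ℕ.* 5))) ⟩
        N !
      ≡⟨ ℕP.*-identityˡ (N !) ⟨
        1 ℕ.* N !
      ∎
      where
      open ≡-Reasoning
      regroup : ∀ p v c s x y f → p ℕ.* (v ℕ.* c) ℕ.* s ℕ.* (x ℕ.* y ℕ.* f) ≡ c ℕ.* (x ℕ.* (v ℕ.* (y ℕ.* (p ℕ.* s ℕ.* f))))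
      regroup = ℕSolver.solve-∀
    frac≡ : fracFact 1 N a b b ≡ + T / 1
    frac≡ = fracFact≡ 1 N a b b T (sym identity)

  odd-case : ∀ k b n a c → n ≡ suc k ℕ.+ suc (2 ℕ.* b) → a ≡ 2 ℕ.* suc k ∸ 1 ∸ b → c ≡ b → b ≤ 2 ℕ.* suc k ∸ 1 →
    IsInt (fracFact 2 (2 ℕ.* n) a c c) × (r n (suc k) ≡₅ fracFact 2 (2 ℕ.* n) a c c)
  odd-case k b _ _ _ refl refl refl b≤2k-1 =
    (+ T , frac≡) , subst (r n (suc k) ≡₅_) (sym frac≡) (r≡₅2^[n∸k]*Y*6^e n (suc k) Y (suc b) F^[]≡Y)
    where
    n = suc k ℕ.+ suc (2 ℕ.* b)
    N = 2 ℕ.* n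
    a = 2 ℕ.* suc k ∸ 1 ∸ b
    Y = (N C 3) ℕ.* (blockPartitions 4 b ℕ.* ((N ∸ 3) C a))
    T = 2 ℕ.^ (n ∸ suc k) ℕ.* Y ℕ.* 6 ℕ.^ suc b
    F^[]≡Y : (F-coeff ^[ 2 ℕ.* suc k ]) N ≡ + Y [mod + 5 ]
    F^[]≡Y = ≡-mod-trans (F-coeff^[]≡G^[] (2 ℕ.* suc k) N) (≡-mod-trans (G^[]-odd k b b≤2k-1) (≡⇒≡-mod (sym
      (trans (ℤP.pos-* (N C 3) _) (cong (+ (N C 3) *_) (ℤP.pos-* (blockPartitions 4 b) ((N ∸ 3) C a)))))))
    N∸3≡a+5b : N ∸ 3 ≡ a ℕ.+ b ℕ.* 5
    N∸3≡a+5b = begin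
        N ∸ 3                                            ≡⟨ cong (_∸ 3) (2[1+k]∸1+l*4+3≡2[2+k+2l] k b) ⟨
        2 ℕ.* suc k ∸ 1 ℕ.+ b ℕ.* 4 ℕ.+ 3 ∸ 3            ≡⟨ ℕP.m+n∸n≡m _ 3 ⟩
        2 ℕ.* suc k ∸ 1 ℕ.+ b ℕ.* 4                      ≡⟨ cong (ℕ._+ b ℕ.* 4) (ℕP.m∸n+n≡m b≤2k-1) ⟨
        a ℕ.+ b ℕ.+ b ℕ.* 4                              ≡⟨ regroup a b ⟩
        a ℕ.+ b ℕ.* 5                                    ∎
      where
      open ≡-Reasoning
      regroup : ∀ a b → a ℕ.+ b ℕ.+ b ℕ.* 4 ≡ a ℕ.+ b ℕ.* 5
      regroup = ℕSolver.solve-∀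
    3≤N : 3 ≤ N
    3≤N = subst (3 ≤_) (2[1+k]∸1+l*4+3≡2[2+k+2l] k b) (ℕP.m≤n+m 3 _)
    identity : T ℕ.* (a ! ℕ.* b ! ℕ.* 5 ℕ.^ b) ≡ 2 ℕ.* N !
    identity = begin
        2 ℕ.^ (n ∸ suc k) ℕ.* Y ℕ.* 6 ℕ.^ suc b ℕ.* (a ! ℕ.* b ! ℕ.* 5 ℕ.^ b)
      ≡⟨ cong (λ t → 2 ℕ.^ t ℕ.* Y ℕ.* 6 ℕ.^ suc b ℕ.* (a ! ℕ.* b ! ℕ.* 5 ℕ.^ b)) (ℕP.m+n∸m≡n (suc k) (suc (2 ℕ.* b))) ⟩
        2 ℕ.* 2 ℕ.^ (2 ℕ.* b) ℕ.* Y ℕ.* 6 ℕ.^ suc b ℕ.* (a ! ℕ.* b ! ℕ.* 5 ℕ.^ b)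
      ≡⟨ cong (λ t → 2 ℕ.* t ℕ.* Y ℕ.* 6 ℕ.^ suc b ℕ.* (a ! ℕ.* b ! ℕ.* 5 ℕ.^ b)) (ℕP.^-*-assoc 2 2 b) ⟨
        2 ℕ.* 4 ℕ.^ b ℕ.* ((N C 3) ℕ.* (blockPartitions 4 b ℕ.* ((N ∸ 3) C a))) ℕ.* (6 ℕ.* 6 ℕ.^ b) ℕ.* (a ! ℕ.* b ! ℕ.* 5 ℕ.^ b)
      ≡⟨ regroup (4 ℕ.^ b) (N C 3) (blockPartitions 4 b) ((N ∸ 3) C a) (6 ℕ.^ b) (a !) (b !) (5 ℕ.^ b) ⟩
        2 ℕ.* ((N C 3) ℕ.* (3 ! ℕ.* (((N ∸ 3) C a) ℕ.* (a ! ℕ.* (blockPartitions 4 b ℕ.* (b ! ℕ.* (4 ℕ.^ b ℕ.* 6 ℕ.^ b ℕ.* 5 ℕ.^ b)))))))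
      ≡⟨ cong (λ t → 2 ℕ.* ((N C 3) ℕ.* (3 ! ℕ.* (((N ∸ 3) C a) ℕ.* (a ! ℕ.* (blockPartitions 4 b ℕ.* (b ! ℕ.* t)))))))
              (4^b*6^b*5^b≡120^b b) ⟩
        2 ℕ.* ((N C 3) ℕ.* (3 ! ℕ.* (((N ∸ 3) C a) ℕ.* (a ! ℕ.* (blockPartitions 4 b ℕ.* (b ! ℕ.* 120 ℕ.^ b))))))
      ≡⟨ cong (λ t → 2 ℕ.* ((N C 3) ℕ.* (3 ! ℕ.* (((N ∸ 3) C a) ℕ.* (a ! ℕ.* t))))) (blockPartitions-factorial 4 b) ⟩
        2 ℕ.* ((N C 3) ℕ.* (3 ! ℕ.* (((N ∸ 3) C a) ℕ.* (a ! ℕ.* (b ℕ.* 5) !))))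
      ≡⟨ cong (λ t → 2 ℕ.* ((N C 3) ℕ.* (3 ! ℕ.* (((N ∸ 3) C a) ℕ.* (a ! ℕ.* t !)))))
              (trans (sym (ℕP.m+n∸m≡n a (b ℕ.* 5))) (cong (_∸ a) (sym N∸3≡a+5b))) ⟩
        2 ℕ.* ((N C 3) ℕ.* (3 ! ℕ.* (((N ∸ 3) C a) ℕ.* (a ! ℕ.* (N ∸ 3 ∸ a) !))))
      ≡⟨ cong (λ t → 2 ℕ.* ((N C 3) ℕ.* (3 ! ℕ.* t))) (nCk*k!*[n∸k]!≡n! (subst (a ≤_) (sym N∸3≡a+5b) (ℕP.m≤m+n a (b ℕ.* 5)))) ⟩
        2 ℕ.* ((N C 3) ℕ.* (3 ! ℕ.* (N ∸ 3) !))
      ≡⟨ cong (2 ℕ.*_) (nCk*k!*[n∸k]!≡n! 3≤N) ⟩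
        2 ℕ.* N !
      ∎
      where
      open ≡-Reasoning
      regroup : ∀ p t v c s x y f → 2 ℕ.* p ℕ.* (t ℕ.* (v ℕ.* c)) ℕ.* (6 ℕ.* s) ℕ.* (x ℕ.* y ℕ.* f)
                                  ≡ 2 ℕ.* (t ℕ.* (6 ℕ.* (c ℕ.* (x ℕ.* (v ℕ.* (y ℕ.* (p ℕ.* s ℕ.* f)))))))
      regroup = ℕSolver.solve-∀
    frac≡ : fracFact 2 N a b b ≡ + T / 1
    frac≡ = fracFact≡ 2 N a b b T (sym identity)

  large-case : ∀ k n → 5 ℕ.* suc k < n → r n (suc k) ≡₅ 0ℚ
  large-case k n 5k<n =
    subst (r n (suc k) ≡₅_) (cong (λ t → + t / 1) (trans (ℕP.*-identityʳ _) (ℕP.*-zeroʳ (2 ℕ.^ (n ∸ suc k)))))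
    (r≡₅2^[n∸k]*Y*6^e n (suc k) 0 0 (≡-mod-trans (F-coeff^[]≡G^[] (2 ℕ.* suc k) (2 ℕ.* n)) (G^[]-large k n 5k<n)))

  halve : ∀ {x c} → x ≡ c ℕ.* 2 → x ℕ./ 2 ≡ c
  halve {c = c} refl = ℕD.m*n/n≡m c 2

  private
    5[1+k]≡1+k+2[2[1+k]] : ∀ k → 5 ℕ.* suc k ≡ suc k ℕ.+ 2 ℕ.* (2 ℕ.* suc k)
    5[1+k]≡1+k+2[2[1+k]] = ℕSolver.solve-∀

  even-split : ∀ {n k} → suc k ≤ n → n ≤ 5 ℕ.* suc k → (n ∸ suc k) ℕ.% 2 ≡ 0 →
    let b = (n ∸ suc k) ℕ./ 2 in
    n ≡ suc k ℕ.+ 2 ℕ.* b × (5 ℕ.* suc k ∸ n) ℕ./ 2 ≡ 2 ℕ.* suc k ∸ b × b ≤ 2 ℕ.* suc k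
  even-split {n} {k} k≤n n≤5k even = n≡ , a≡ , b≤2k
    where
    open ≡-Reasoning
    b = (n ∸ suc k) ℕ./ 2
    n≡ : n ≡ suc k ℕ.+ 2 ℕ.* b
    n≡ = trans (sym (ℕP.m+[n∸m]≡n k≤n))
               (cong (suc k ℕ.+_) (trans (ℕD.m≡m%n+[m/n]*n (n ∸ suc k) 2) (trans (cong (ℕ._+ b ℕ.* 2) even) (ℕP.*-comm b 2))))
    b≤2k : b ≤ 2 ℕ.* suc k
    b≤2k = ℕP.*-cancelˡ-≤ 2 (ℕP.+-cancelˡ-≤ (suc k) _ _ (subst₂ _≤_ n≡ (5[1+k]≡1+k+2[2[1+k]] k) n≤5k))
    a≡ : (5 ℕ.* suc k ∸ n) ℕ./ 2 ≡ 2 ℕ.* suc k ∸ b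
    a≡ = halve (begin
        5 ℕ.* suc k ∸ n                                        ≡⟨ cong₂ _∸_ (5[1+k]≡1+k+2[2[1+k]] k) n≡ ⟩
        suc k ℕ.+ 2 ℕ.* (2 ℕ.* suc k) ∸ (suc k ℕ.+ 2 ℕ.* b)    ≡⟨ ℕP.[m+n]∸[m+o]≡n∸o (suc k) _ _ ⟩
        2 ℕ.* (2 ℕ.* suc k) ∸ 2 ℕ.* b                          ≡⟨ ℕP.*-distribˡ-∸ 2 (2 ℕ.* suc k) b ⟨
        2 ℕ.* (2 ℕ.* suc k ∸ b)                                ≡⟨ ℕP.*-comm 2 (2 ℕ.* suc k ∸ b) ⟩
        (2 ℕ.* suc k ∸ b) ℕ.* 2                                ∎)

  odd-split : ∀ {n k} → suc k ≤ n → n ≤ 5 ℕ.* suc k → (n ∸ suc k) ℕ.% 2 ≡ 1 →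
    let b = (n ∸ suc k) ℕ./ 2 in
    n ≡ suc k ℕ.+ suc (2 ℕ.* b) × (5 ℕ.* suc k ∸ n ∸ 1) ℕ./ 2 ≡ 2 ℕ.* suc k ∸ 1 ∸ b
      × (n ∸ suc k ∸ 1) ℕ./ 2 ≡ b × b ≤ 2 ℕ.* suc k ∸ 1
  odd-split {n} {k} k≤n n≤5k odd = n≡ , a≡ , c≡ , b≤2k-1
    where
    open ≡-Reasoning
    b = (n ∸ suc k) ℕ./ 2
    n∸k≡1+2b : n ∸ suc k ≡ suc (2 ℕ.* b)
    n∸k≡1+2b = trans (ℕD.m≡m%n+[m/n]*n (n ∸ suc k) 2) (trans (cong (ℕ._+ b ℕ.* 2) odd) (cong suc (ℕP.*-comm b 2)))
    n≡ : n ≡ suc k ℕ.+ suc (2 ℕ.* b)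
    n≡ = trans (sym (ℕP.m+[n∸m]≡n k≤n)) (cong (suc k ℕ.+_) n∸k≡1+2b)
    b≤2k-1 : b ≤ 2 ℕ.* suc k ∸ 1
    b≤2k-1 = ℕP.≤-pred (ℕP.*-cancelˡ-< 2 b (2 ℕ.* suc k)
      (ℕP.+-cancelˡ-≤ (suc k) _ _ (subst₂ _≤_ n≡ (5[1+k]≡1+k+2[2[1+k]] k) n≤5k)))
    a≡ : (5 ℕ.* suc k ∸ n ∸ 1) ℕ./ 2 ≡ 2 ℕ.* suc k ∸ 1 ∸ b
    a≡ = halve (begin
        5 ℕ.* suc k ∸ n ∸ 1                                           ≡⟨ cong₂ (λ x y → x ∸ y ∸ 1) (5[1+k]≡1+k+2[2[1+k]] k) n≡ ⟩
        suc k ℕ.+ 2 ℕ.* (2 ℕ.* suc k) ∸ (suc k ℕ.+ suc (2 ℕ.* b)) ∸ 1 ≡⟨ cong (_∸ 1) (ℕP.[m+n]∸[m+o]≡n∸o (suc k) _ _) ⟩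
        2 ℕ.* (2 ℕ.* suc k) ∸ suc (2 ℕ.* b) ∸ 1                       ≡⟨ ℕP.∸-+-assoc (2 ℕ.* (2 ℕ.* suc k)) (suc (2 ℕ.* b)) 1 ⟩
        2 ℕ.* (2 ℕ.* suc k) ∸ (suc (2 ℕ.* b) ℕ.+ 1)                   ≡⟨ cong (2 ℕ.* (2 ℕ.* suc k) ∸_) (double-suc b) ⟩
        2 ℕ.* (2 ℕ.* suc k) ∸ 2 ℕ.* suc b                             ≡⟨ ℕP.*-distribˡ-∸ 2 (2 ℕ.* suc k) (suc b) ⟨
        2 ℕ.* (2 ℕ.* suc k ∸ suc b)                                   ≡⟨ cong (2 ℕ.*_) (ℕP.∸-+-assoc (2 ℕ.* suc k) 1 b) ⟨
        2 ℕ.* (2 ℕ.* suc k ∸ 1 ∸ b)                                   ≡⟨ ℕP.*-comm 2 (2 ℕ.* suc k ∸ 1 ∸ b) ⟩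
        (2 ℕ.* suc k ∸ 1 ∸ b) ℕ.* 2                                   ∎)
      where
      double-suc : ∀ b → suc (2 ℕ.* b) ℕ.+ 1 ≡ 2 ℕ.* suc b
      double-suc = ℕSolver.solve-∀
    c≡ : (n ∸ suc k ∸ 1) ℕ./ 2 ≡ b
    c≡ = halve (trans (cong (_∸ 1) n∸k≡1+2b) (ℕP.*-comm 2 b))

  r≡₅-even : ∀ n k → 1 ≤ k → k ≤ n → n ≤ 5 ℕ.* k → (n ∸ k) ℕ.% 2 ≡ 0 →
    IsInt (fracFact 1 (2 ℕ.* n) ((5 ℕ.* k ∸ n) ℕ./ 2) ((n ∸ k) ℕ./ 2) ((n ∸ k) ℕ./ 2))
    × (r n k ≡₅ fracFact 1 (2 ℕ.* n) ((5 ℕ.* k ∸ n) ℕ./ 2) ((n ∸ k) ℕ./ 2) ((n ∸ k) ℕ./ 2))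
  r≡₅-even n (suc k) _ k≤n n≤5k even with even-split k≤n n≤5k even
  ... | n≡ , a≡ , b≤2k = even-case k _ n _ _ n≡ a≡ refl b≤2k

  r≡₅-odd : ∀ n k → 1 ≤ k → k ≤ n → n ≤ 5 ℕ.* k → (n ∸ k) ℕ.% 2 ≡ 1 →
    IsInt (fracFact 2 (2 ℕ.* n) ((5 ℕ.* k ∸ n ∸ 1) ℕ./ 2) ((n ∸ k ∸ 1) ℕ./ 2) ((n ∸ k ∸ 1) ℕ./ 2))
    × (r n k ≡₅ fracFact 2 (2 ℕ.* n) ((5 ℕ.* k ∸ n ∸ 1) ℕ./ 2) ((n ∸ k ∸ 1) ℕ./ 2) ((n ∸ k ∸ 1) ℕ./ 2))
  r≡₅-odd n (suc k) _ k≤n n≤5k odd with odd-split k≤n n≤5k odd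
  ... | n≡ , a≡ , c≡ , b≤2k-1 = odd-case k _ n _ _ n≡ a≡ c≡ b≤2k-1

  r≡₅-large : ∀ n k → 1 ≤ k → 5 ℕ.* k < n → r n k ≡₅ 0ℚ
  r≡₅-large n (suc k) _ 5k<n = large-case k n 5k<n

open import Data.Nat using (_*_; _/_; _%_)
open import Data.Product using (_×_; _,_)
open import Data.Rational using (0ℚ)
open import Defs
open CongruencesOfR using (r≡₅-even; r≡₅-odd; r≡₅-large)

theorem10 :
    (∀ n k → 1 ≤ k → k ≤ n → n ≤ 5 * k → (n ∸ k) % 2 ≡ 0 →
      IsInt (fracFact 1 (2 * n) ((5 * k ∸ n) / 2) ((n ∸ k) / 2) ((n ∸ k) / 2))
      × (r n k ≡₅ fracFact 1 (2 * n) ((5 * k ∸ n) / 2) ((n ∸ k) / 2) ((n ∸ k) / 2)))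
    × (∀ n k → 1 ≤ k → k ≤ n → n ≤ 5 * k → (n ∸ k) % 2 ≡ 1 →
      IsInt (fracFact 2 (2 * n) ((5 * k ∸ n ∸ 1) / 2) ((n ∸ k ∸ 1) / 2) ((n ∸ k ∸ 1) / 2))
      × (r n k ≡₅ fracFact 2 (2 * n) ((5 * k ∸ n ∸ 1) / 2) ((n ∸ k ∸ 1) / 2) ((n ∸ k ∸ 1) / 2)))
    × (∀ n k → 1 ≤ k → 5 * k < n → r n k ≡₅ 0ℚ)
theorem10 = r≡₅-even , r≡₅-odd , r≡₅-large
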